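{- The numbers $c_{n,m,r,s}=|C_{n,m,r,s}|$ and $d_{n,m,r,s}=|D_{n,m,r,s}|$ can be non-zero only when $n\ge1$ and $0\le s\le r\le m<n$. They satisfy $c_{1,0,0,0}=1$, $d_{1,0,0,0}=0$, and for $n\ge 2$: $$c_{n,m,r,s}=c_{n-1,m,r,s}+d_{n,m,r,s}+\sum_{i=0}^{s-1}c_{n-1,m-1,r,i},\qquad 0\le s<r\le m,$$ $$d_{n,m,r,s}=d_{n-1,m,r,s}+\sum_{i=s+1}^{r-1}d_{n-1,m-1,i,s}+\sum_{i=0}^{s}\sum_{j=i}^{r}c_{n-2,m-1,j,i},\qquad 0\le s<r\le m,$$ $$c_{n,m,r,r}=d_{n,m,r,r}+\sum_{i=0}^{r-1}\sum_{j=i}^{r}c_{n-1,m-1,j,i},\qquad 0\le r\le m,$$ $$d_{n,m,r,r}=c_{n-1,m,r,r},\qquad 0\le r\le m.$$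
   Context: An ascent in a sequence $x_1\cdots x_k$ is an index $j$ with $x_j<x_{j+1}$; $\mathrm{asc}(x)$ is the number of ascents. An ascent sequence of length $n$ is a sequence $x_1\cdots x_n$ of non-negative integers with $x_1=0$ and $x_i\le\mathrm{asc}(x_1\cdots x_{i-1})+1$ for $1<i\le n$. A sequence $\pi$ contains the pattern $210$ if there are indices $a<b<c$ with $\pi_a>\pi_b>\pi_c$; otherwise it avoids $210$. $\mathcal{S}_{210}(n)$ is the set of ascent sequences of length $n$ avoiding $210$. $C_{n,m,r,s}$ is the set of members of $\mathcal{S}_{210}(n)$ with exactly $m$ ascents, largest letter $r$ and last letter $s$; $D_{n,m,r,s}$ is the subset of $C_{n,m,r,s}$ consisting of those sequences whose next-to-last letter is $r$. These sets are defined (and empty, hence counted by $0$) for all integer indices. -}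

module Defs where

open import Data.Bool using (Bool; true; false; _∧_; _∨_; not; if_then_else_)
open import Data.Nat using (ℕ; zero; suc; _+_; _∸_; _⊔_; _<ᵇ_; _≡ᵇ_)
open import Data.Integer using (ℤ; +_)
open import Data.List using (List; []; _∷_; length; map; concatMap; filterᵇ; foldr; upTo)
open import Data.Bool.ListAction using (any)

-- Sequences x₁ ⋯ x_k are lists, x₁ being the head.

_≤ᵇ'_ : ℕ → ℕ → Bool
x ≤ᵇ' y = x <ᵇ suc y

asc : List ℕ → ℕ
asc []            = 0
asc (x ∷ [])      = 0
asc (x ∷ y ∷ t)   = (if x <ᵇ y then 1 else 0) + asc (y ∷ t)

-- Ascent-sequence condition, scanning left to right.
-- go p a t : p is the last letter of the prefix read so far, a = asc(prefix),
-- t = remaining letters; each new letter x must satisfy x ≤ a + 1.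
ascOK : ℕ → ℕ → List ℕ → Bool
ascOK p a []      = true
ascOK p a (x ∷ t) = (x ≤ᵇ' suc a) ∧ ascOK x ((if p <ᵇ x then 1 else 0) + a) t

-- x₁ ⋯ x_n is an ascent sequence (the empty list counts vacuously; it never
-- lies in any C or D since it has no last letter)
isAscentSeq : List ℕ → Bool
isAscentSeq []      = true
isAscentSeq (x ∷ t) = (x ≡ᵇ 0) ∧ ascOK x 0 t

has21 : List ℕ → Bool
has21 []      = false
has21 (y ∷ t) = any (λ z → z <ᵇ y) t ∨ has21 t

contains210 : List ℕ → Bool
contains210 []      = false
contains210 (x ∷ t) = has21 (filterᵇ (λ z → z <ᵇ x) t) ∨ contains210 t

allLists : ℕ → ℕ → List (List ℕ)
allLists zero    k = [] ∷ []
allLists (suc n) k = concatMap (λ x → map (x ∷_) (allLists n k)) (upTo k)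

-- S₂₁₀(n): ascent sequences of length n avoiding 210.  Every letter of an
-- ascent sequence of length n is ≤ n - 1 (x_i ≤ asc(x₁⋯x_{i-1}) + 1 ≤ i - 1),
-- so enumerating lists with entries < n is exhaustive.
S210 : ℕ → List (List ℕ)
S210 n = filterᵇ (λ x → isAscentSeq x ∧ not (contains210 x)) (allLists n n)

maxLetter : List ℕ → ℕ
maxLetter = foldr _⊔_ 0

lastIs : ℕ → List ℕ → Bool
lastIs s []          = false
lastIs s (x ∷ [])    = x ≡ᵇ s
lastIs s (x ∷ y ∷ t) = lastIs s (y ∷ t)

nextToLastIs : ℕ → List ℕ → Bool
nextToLastIs r []              = false
nextToLastIs r (x ∷ [])        = false
nextToLastIs r (x ∷ y ∷ [])    = x ≡ᵇ r
nextToLastIs r (x ∷ y ∷ z ∷ t) = nextToLastIs r (y ∷ z ∷ t)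

inC : ℕ → ℕ → ℕ → List ℕ → Bool
inC m r s x = (asc x ≡ᵇ m) ∧ (maxLetter x ≡ᵇ r) ∧ lastIs s x

cℕ : ℕ → ℕ → ℕ → ℕ → ℕ
cℕ n m r s = length (filterᵇ (inC m r s) (S210 n))

dℕ : ℕ → ℕ → ℕ → ℕ → ℕ
dℕ n m r s = length (filterᵇ (λ x → inC m r s x ∧ nextToLastIs r x) (S210 n))

-- c and d for all integer indices (the sets are empty if an index is negative)
c : ℤ → ℤ → ℤ → ℤ → ℕ
c (+ n) (+ m) (+ r) (+ s) = cℕ n m r s
c _ _ _ _ = 0

d : ℤ → ℤ → ℤ → ℤ → ℕ
d (+ n) (+ m) (+ r) (+ s) = dℕ n m r s
d _ _ _ _ = 0

sumTo : ℕ → (ℕ → ℕ) → ℕ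
sumTo zero    f = 0
sumTo (suc k) f = sumTo k f + f k

-- Σ_{i=a}^{b} f i  (empty if b < a)
sumFT : ℕ → ℕ → (ℕ → ℕ) → ℕ
sumFT a b f = sumTo (suc b ∸ a) (λ k → f (a + k))

-- Every count is a sum, over all words of a fixed length on a large enough alphabet, of the
-- indicator of a decidable membership test, so each recurrence can be proved termwise: with all
-- but the last one or two letters fixed, the indicator for the longer word equals the matching
-- combination of indicators for shorter words. This is a case analysis on the letter t preceding
-- the deleted letter. Deleting a last letter s lowers the number of ascents by [t < s], keeps the
-- word a 210-avoiding ascent sequence, and can be undone exactly when s respects the ascent bound
-- and closes no 210. For example, if x t s ∈ C with s < t and s < r, then t = r, for otherwise an
-- earlier r followed by t and s would form a 210; so x t s ∈ D. In x t r s ∈ D with s < r, the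
-- letter r can be removed: for s < t < r this gives x t s ∈ D_{n-1,m-1,t,s}, for t ≤ s it gives
-- x t ∈ C_{n-2,m-1,j,t} with j = max(x t) ≤ r, and for t = r it merely deletes a repeated letter.

module Submission where

open import Defs
open import Data.Nat using (ℕ; _+_; _∸_; _≤_; _<_)
open import Data.Integer using (ℤ; +_; _-_; 1ℤ; 0ℤ) renaming (_≤_ to _≤ℤ_; _<_ to _<ℤ_)
open import Data.Product using (_×_)
open import Relation.Binary.PropositionalEquality using (_≡_; _≢_)

open import Algebra.Properties.CommutativeSemigroup using (interchange)
open import Data.Bool using (Bool; true; false; _∧_; _∨_; not; if_then_else_; T)
open import Data.Bool.ListAction using (any)
open import Data.Bool.Properties using (T-∧; T-∨; ∨-assoc; ∨-comm; ∨-idem; ∧-assoc; ∧-comm; ∧-identityʳ; ∨-identityʳ; ∧-zeroʳ; ∧-distribˡ-∨; ∨-commutativeMonoid)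
open import Data.Empty using (⊥-elim)
open import Data.Integer using (-[1+_]; +≤+; +<+)
open import Data.List using (List; []; _∷_; length; map; concatMap; filterᵇ; upTo; applyUpTo; _++_; reverse)
open import Data.List.Properties using (unfold-reverse; reverse-++; reverse-involutive; ++-identityʳ)
open import Data.List.Relation.Unary.Any as Any using (Any; here; there)
open import Data.Nat using (zero; suc; _⊔_; _<ᵇ_; _≡ᵇ_; z≤n; s≤s; z<s)
open import Data.Nat.Properties
open import Data.Product using (_,_; proj₁; proj₂; ∃)
open import Data.Sum using (_⊎_; inj₁; inj₂)
open import Data.Unit using (tt)
open import Function using (_∘_; id)
open import Algebra.Bundles using (CommutativeMonoid)
open import Relation.Binary.Definitions using (tri<; tri≈; tri>)
open import Relation.Binary.PropositionalEquality using (refl; sym; trans; cong; cong₂; subst; module ≡-Reasoning)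
open import Relation.Nullary using (¬_; yes; no; contradiction)

open import Function.Bundles using (Equivalence; _⇔_; mk⇔)

private
  T-∧⁻ : ∀ {a b} → T (a ∧ b) → T a × T b
  T-∧⁻ = Equivalence.to T-∧

  T-∧⁺ : ∀ {a b} → T a → T b → T (a ∧ b)
  T-∧⁺ ta tb = Equivalence.from T-∧ (ta , tb)

  T-∨⁻ : ∀ {a b} → T (a ∨ b) → T a ⊎ T b
  T-∨⁻ = Equivalence.to T-∨

  T-not⁻ : ∀ {a} → T (not a) → ¬ T a
  T-not⁻ {true}  () _
  T-not⁻ {false} _  ()

  T-not⁺ : ∀ {a} → ¬ T a → T (not a)
  T-not⁺ {true}  ¬a = ¬a tt
  T-not⁺ {false} ¬a = tt

  +-interchange : ∀ a b c d → (a + b) + (c + d) ≡ (a + c) + (b + d)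
  +-interchange = interchange +-commutativeSemigroup

  ∨-interchange : ∀ a b c d → (a ∨ b) ∨ (c ∨ d) ≡ (a ∨ c) ∨ (b ∨ d)
  ∨-interchange = interchange (CommutativeMonoid.commutativeSemigroup ∨-commutativeMonoid)

-- Finite sums

𝟙 : Bool → ℕ
𝟙 b = if b then 1 else 0

𝟙-false : ∀ {b} → ¬ T b → 𝟙 b ≡ 0
𝟙-false {true}  ¬b = ⊥-elim (¬b tt)
𝟙-false {false} ¬b = refl

𝟙≢0⇒T : ∀ b → 𝟙 b ≢ 0 → T b
𝟙≢0⇒T true  _   = tt
𝟙≢0⇒T false 𝟙≢0 = 𝟙≢0 refl

𝟙-cong : ∀ {a b} → T a ⇔ T b → 𝟙 a ≡ 𝟙 b
𝟙-cong {true}  {true}  _   = refl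
𝟙-cong {false} {false} _   = refl
𝟙-cong {true}  {false} a⇔b = ⊥-elim (Equivalence.to a⇔b tt)
𝟙-cong {false} {true}  a⇔b = ⊥-elim (Equivalence.from a⇔b tt)

sumOver : {A : Set} → List A → (A → ℕ) → ℕ
sumOver []       f = 0
sumOver (x ∷ xs) f = f x + sumOver xs f

module _ {A : Set} where

  sumOver-cong : ∀ (xs : List A) {f g : A → ℕ} → (∀ x → f x ≡ g x) → sumOver xs f ≡ sumOver xs g
  sumOver-cong []       f≗g = refl
  sumOver-cong (x ∷ xs) f≗g = cong₂ _+_ (f≗g x) (sumOver-cong xs f≗g)

  sumOver-≡0 : ∀ (xs : List A) {f : A → ℕ} → (∀ x → f x ≡ 0) → sumOver xs f ≡ 0
  sumOver-≡0 []       f≡0 = refl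
  sumOver-≡0 (x ∷ xs) f≡0 = cong₂ _+_ (f≡0 x) (sumOver-≡0 xs f≡0)

  sumOver-+ : ∀ (xs : List A) (f g : A → ℕ) →
              sumOver xs (λ x → f x + g x) ≡ sumOver xs f + sumOver xs g
  sumOver-+ []       f g = refl
  sumOver-+ (x ∷ xs) f g = trans (cong (_+_ (f x + g x)) (sumOver-+ xs f g))
                                 (+-interchange (f x) (g x) (sumOver xs f) (sumOver xs g))

  sumOver-++ : ∀ (xs ys : List A) (f : A → ℕ) → sumOver (xs ++ ys) f ≡ sumOver xs f + sumOver ys f
  sumOver-++ []       ys f = refl
  sumOver-++ (x ∷ xs) ys f = trans (cong (_+_ (f x)) (sumOver-++ xs ys f)) (sym (+-assoc (f x) _ _))

  sumOver-map : ∀ {B : Set} (h : B → A) (xs : List B) (f : A → ℕ) →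
                sumOver (map h xs) f ≡ sumOver xs (f ∘ h)
  sumOver-map h []       f = refl
  sumOver-map h (x ∷ xs) f = cong (_+_ (f (h x))) (sumOver-map h xs f)

  sumOver-concatMap : ∀ {B : Set} (h : B → List A) (xs : List B) (f : A → ℕ) →
                      sumOver (concatMap h xs) f ≡ sumOver xs (λ x → sumOver (h x) f)
  sumOver-concatMap h []       f = refl
  sumOver-concatMap h (x ∷ xs) f = trans (sumOver-++ (h x) (concatMap h xs) f)
                                         (cong (_+_ (sumOver (h x) f)) (sumOver-concatMap h xs f))

  sumOver-filterᵇ : ∀ (p : A → Bool) (xs : List A) (f : A → ℕ) →
                    sumOver (filterᵇ p xs) f ≡ sumOver xs (λ x → if p x then f x else 0)
  sumOver-filterᵇ p []       f = refl
  sumOver-filterᵇ p (x ∷ xs) f with p x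
  ... | true  = cong (_+_ (f x)) (sumOver-filterᵇ p xs f)
  ... | false = sumOver-filterᵇ p xs f

  length≡sumOver1 : ∀ (xs : List A) → length xs ≡ sumOver xs (λ _ → 1)
  length≡sumOver1 []       = refl
  length≡sumOver1 (x ∷ xs) = cong suc (length≡sumOver1 xs)

  length-filterᵇ-filterᵇ : ∀ (p q : A → Bool) (xs : List A) →
                           length (filterᵇ q (filterᵇ p xs)) ≡ sumOver xs (λ x → 𝟙 (p x ∧ q x))
  length-filterᵇ-filterᵇ p q xs = begin
    length (filterᵇ q (filterᵇ p xs))
      ≡⟨ length≡sumOver1 (filterᵇ q (filterᵇ p xs)) ⟩
    sumOver (filterᵇ q (filterᵇ p xs)) (λ _ → 1)
      ≡⟨ sumOver-filterᵇ q (filterᵇ p xs) _ ⟩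
    sumOver (filterᵇ p xs) (λ x → 𝟙 (q x))
      ≡⟨ sumOver-filterᵇ p xs _ ⟩
    sumOver xs (λ x → if p x then 𝟙 (q x) else 0)
      ≡⟨ sumOver-cong xs (λ x → if-𝟙 (p x) (q x)) ⟩
    sumOver xs (λ x → 𝟙 (p x ∧ q x)) ∎
    where
    open ≡-Reasoning
    if-𝟙 : ∀ a b → (if a then 𝟙 b else 0) ≡ 𝟙 (a ∧ b)
    if-𝟙 true  b = refl
    if-𝟙 false b = refl

sumTo-cong : ∀ k {f g : ℕ → ℕ} → (∀ i → f i ≡ g i) → sumTo k f ≡ sumTo k g
sumTo-cong zero    f≗g = refl
sumTo-cong (suc k) f≗g = cong₂ _+_ (sumTo-cong k f≗g) (f≗g k)

sumTo-≡0 : ∀ k (f : ℕ → ℕ) → (∀ i → i < k → f i ≡ 0) → sumTo k f ≡ 0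
sumTo-≡0 zero    f f≡0 = refl
sumTo-≡0 (suc k) f f≡0 = cong₂ _+_ (sumTo-≡0 k f (λ i i<k → f≡0 i (m<n⇒m<1+n i<k))) (f≡0 k ≤-refl)

sumTo-suc : ∀ k (f : ℕ → ℕ) → sumTo (suc k) f ≡ f 0 + sumTo k (f ∘ suc)
sumTo-suc zero    f = +-comm 0 (f 0)
sumTo-suc (suc k) f = trans (cong (_+ f (suc k)) (sumTo-suc k f)) (+-assoc (f 0) _ _)

sumTo-+ : ∀ k (f g : ℕ → ℕ) → sumTo k (λ i → f i + g i) ≡ sumTo k f + sumTo k g
sumTo-+ zero    f g = refl
sumTo-+ (suc k) f g = trans (cong (_+ (f k + g k)) (sumTo-+ k f g))
                            (+-interchange (sumTo k f) (sumTo k g) (f k) (g k))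

sumTo-swap : ∀ a b (f : ℕ → ℕ → ℕ) →
             sumTo a (λ i → sumTo b (f i)) ≡ sumTo b (λ j → sumTo a (λ i → f i j))
sumTo-swap zero    b f = sym (sumTo-≡0 b _ (λ _ _ → refl))
sumTo-swap (suc a) b f = trans (cong (_+ sumTo b (f a)) (sumTo-swap a b f))
                               (sym (sumTo-+ b (λ j → sumTo a (λ i → f i j)) (f a)))

sumTo-single : ∀ k (f : ℕ → ℕ) t → t < k → (∀ i → i ≢ t → f i ≡ 0) → sumTo k f ≡ f t
sumTo-single (suc k) f t t<1+k f≡0 with t ≟ k
... | yes refl = cong (_+ f k) (sumTo-≡0 k f (λ i i<k → f≡0 i (λ i≡k → <-irrefl i≡k i<k)))
... | no  t≢k  = trans (cong₂ _+_ (sumTo-single k f t (≤∧≢⇒< (≤-pred t<1+k) t≢k) f≡0)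
                                  (f≡0 k (t≢k ∘ sym)))
                       (+-identityʳ (f t))

sumTo-nonzero : ∀ k (f : ℕ → ℕ) → sumTo k f ≢ 0 → ∃ λ i → f i ≢ 0
sumTo-nonzero zero    f ≢0 = ⊥-elim (≢0 refl)
sumTo-nonzero (suc k) f ≢0 with f k ≟ 0
... | no  fk≢0 = k , fk≢0
... | yes fk≡0 = sumTo-nonzero k f (λ sum≡0 → ≢0 (cong₂ _+_ sum≡0 fk≡0))

sumOver-sumTo : ∀ {A : Set} (xs : List A) k (f : ℕ → A → ℕ) →
                sumOver xs (λ x → sumTo k (λ i → f i x)) ≡ sumTo k (λ i → sumOver xs (f i))
sumOver-sumTo []       k f = sym (sumTo-≡0 k _ (λ _ _ → refl))
sumOver-sumTo (x ∷ xs) k f = trans (cong (_+_ (sumTo k (λ i → f i x))) (sumOver-sumTo xs k f))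
                                   (sym (sumTo-+ k (λ i → f i x) (λ i → sumOver xs (f i))))

sumOver-applyUpTo : ∀ (h : ℕ → ℕ) k (f : ℕ → ℕ) → sumOver (applyUpTo h k) f ≡ sumTo k (f ∘ h)
sumOver-applyUpTo h zero    f = refl
sumOver-applyUpTo h (suc k) f = trans (cong (_+_ (f (h 0))) (sumOver-applyUpTo (h ∘ suc) k f))
                                      (sym (sumTo-suc k (f ∘ h)))

k<1+b∸a⇒a+k≤b : ∀ a b k → k < suc b ∸ a → a + k ≤ b
k<1+b∸a⇒a+k≤b zero    b       k k< = ≤-pred k<
k<1+b∸a⇒a+k≤b (suc a) zero    k k< = contradiction (≤-trans k< (≤-reflexive (0∸n≡0 a))) λ ()
k<1+b∸a⇒a+k≤b (suc a) (suc b) k k< = s≤s (k<1+b∸a⇒a+k≤b a b k k<)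

sumFT-cong : ∀ a b {f g : ℕ → ℕ} → (∀ i → f i ≡ g i) → sumFT a b f ≡ sumFT a b g
sumFT-cong a b f≗g = sumTo-cong (suc b ∸ a) (λ k → f≗g (a + k))

sumFT-≡0 : ∀ a b (f : ℕ → ℕ) → (∀ i → a ≤ i → i ≤ b → f i ≡ 0) → sumFT a b f ≡ 0
sumFT-≡0 a b f f≡0 = sumTo-≡0 (suc b ∸ a) (λ k → f (a + k))
  (λ k k< → f≡0 (a + k) (m≤m+n a k) (k<1+b∸a⇒a+k≤b a b k k<))

sumFT-single : ∀ a b (f : ℕ → ℕ) t → a ≤ t → t ≤ b → (∀ i → i ≢ t → f i ≡ 0) → sumFT a b f ≡ f t
sumFT-single a b f t a≤t t≤b f≡0 = trans
  (sumTo-single (suc b ∸ a) (λ k → f (a + k)) (t ∸ a) (∸-monoˡ-< (s≤s t≤b) a≤t)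
    (λ k k≢t∸a → f≡0 (a + k) (λ a+k≡t → k≢t∸a (trans (sym (m+n∸m≡n a k)) (cong (_∸ a) a+k≡t)))))
  (cong f (m+[n∸m]≡n a≤t))

-- Sums over all words of a given length

sumLists : ℕ → ℕ → (List ℕ → ℕ) → ℕ
sumLists n k f = sumOver (allLists n k) f

sumLists-cong : ∀ n k {f g : List ℕ → ℕ} → (∀ l → f l ≡ g l) → sumLists n k f ≡ sumLists n k g
sumLists-cong n k = sumOver-cong (allLists n k)

sumLists-+ : ∀ n k (f g : List ℕ → ℕ) → sumLists n k (λ l → f l + g l) ≡ sumLists n k f + sumLists n k g
sumLists-+ n k = sumOver-+ (allLists n k)

sumLists-+₃ : ∀ n k (f g h : List ℕ → ℕ) →
              sumLists n k (λ l → f l + g l + h l) ≡ sumLists n k f + sumLists n k g + sumLists n k h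
sumLists-+₃ n k f g h = trans (sumLists-+ n k _ h) (cong (_+ sumLists n k h) (sumLists-+ n k f g))

sumLists-sumTo : ∀ n k a (f : ℕ → List ℕ → ℕ) →
                 sumLists n k (λ l → sumTo a (λ i → f i l)) ≡ sumTo a (λ i → sumLists n k (f i))
sumLists-sumTo n k = sumOver-sumTo (allLists n k)

sumLists-sumFT : ∀ n k a b (f : ℕ → List ℕ → ℕ) →
                 sumLists n k (λ l → sumFT a b (λ i → f i l)) ≡ sumFT a b (λ i → sumLists n k (f i))
sumLists-sumFT n k a b f = sumLists-sumTo n k (suc b ∸ a) (λ i → f (a + i))

sumLists-∷ : ∀ n k f → sumLists (suc n) k f ≡ sumTo k (λ x → sumLists n k (λ l → f (x ∷ l)))
sumLists-∷ n k f = begin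
  sumOver (concatMap (λ x → map (x ∷_) (allLists n k)) (upTo k)) f
    ≡⟨ sumOver-concatMap (λ x → map (x ∷_) (allLists n k)) (upTo k) f ⟩
  sumOver (upTo k) (λ x → sumOver (map (x ∷_) (allLists n k)) f)
    ≡⟨ sumOver-cong (upTo k) (λ x → sumOver-map (x ∷_) (allLists n k) f) ⟩
  sumOver (upTo k) (λ x → sumLists n k (λ l → f (x ∷ l)))
    ≡⟨ sumOver-applyUpTo id k _ ⟩
  sumTo k (λ x → sumLists n k (λ l → f (x ∷ l))) ∎
  where open ≡-Reasoning

sumLists-∷ʳ : ∀ n k f → sumLists (suc n) k f ≡ sumTo k (λ x → sumLists n k (λ l → f (l ++ x ∷ [])))
sumLists-∷ʳ zero    k f = sumLists-∷ zero k f
sumLists-∷ʳ (suc n) k f = begin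
  sumLists (suc (suc n)) k f
    ≡⟨ sumLists-∷ (suc n) k f ⟩
  sumTo k (λ y → sumLists (suc n) k (λ l → f (y ∷ l)))
    ≡⟨ sumTo-cong k (λ y → sumLists-∷ʳ n k (λ l → f (y ∷ l))) ⟩
  sumTo k (λ y → sumTo k (λ x → sumLists n k (λ l → f (y ∷ l ++ x ∷ []))))
    ≡⟨ sumTo-swap k k _ ⟩
  sumTo k (λ x → sumTo k (λ y → sumLists n k (λ l → f (y ∷ l ++ x ∷ []))))
    ≡⟨ sumTo-cong k (λ x → sym (sumLists-∷ n k (λ l → f (l ++ x ∷ [])))) ⟩
  sumTo k (λ x → sumLists (suc n) k (λ l → f (l ++ x ∷ []))) ∎
  where open ≡-Reasoning

sumLists-reverse : ∀ n k f → sumLists n k (f ∘ reverse) ≡ sumLists n k f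
sumLists-reverse zero    k f = refl
sumLists-reverse (suc n) k f = begin
  sumLists (suc n) k (f ∘ reverse)
    ≡⟨ sumLists-∷ʳ n k _ ⟩
  sumTo k (λ x → sumLists n k (λ l → f (reverse (l ++ x ∷ []))))
    ≡⟨ sumTo-cong k (λ x → sumLists-cong n k (λ l → cong f (reverse-++ l (x ∷ [])))) ⟩
  sumTo k (λ x → sumLists n k (λ l → f (x ∷ reverse l)))
    ≡⟨ sumTo-cong k (λ x → sumLists-reverse n k (λ l → f (x ∷ l))) ⟩
  sumTo k (λ x → sumLists n k (λ l → f (x ∷ l)))
    ≡⟨ sym (sumLists-∷ n k f) ⟩
  sumLists (suc n) k f ∎
  where open ≡-Reasoning

sumLists-cong-∷ : ∀ n k {f g} → (∀ x l → f (x ∷ l) ≡ g (x ∷ l)) → sumLists (suc n) k f ≡ sumLists (suc n) k g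
sumLists-cong-∷ n k {f} {g} f≗g = begin
  sumLists (suc n) k f                                ≡⟨ sumLists-∷ n k f ⟩
  sumTo k (λ x → sumLists n k (λ l → f (x ∷ l)))      ≡⟨ sumTo-cong k (λ x → sumLists-cong n k (f≗g x)) ⟩
  sumTo k (λ x → sumLists n k (λ l → g (x ∷ l)))      ≡⟨ sym (sumLists-∷ n k g) ⟩
  sumLists (suc n) k g                                ∎
  where open ≡-Reasoning

sumLists-head : ∀ n k f s → s < k → (∀ x l → x ≢ s → f (x ∷ l) ≡ 0) →
                sumLists (suc n) k f ≡ sumLists n k (λ l → f (s ∷ l))
sumLists-head n k f s s<k f≡0 = trans (sumLists-∷ n k f)
  (sumTo-single k _ s s<k (λ x x≢s → sumOver-≡0 (allLists n k) (λ l → f≡0 x l x≢s)))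

sumLists-≡0 : ∀ n k f → (∀ l → length l ≡ n → f l ≡ 0) → sumLists n k f ≡ 0
sumLists-≡0 zero    k f f≡0 = cong (_+ 0) (f≡0 [] refl)
sumLists-≡0 (suc n) k f f≡0 = trans (sumLists-∷ n k f)
  (sumTo-≡0 k _ (λ x _ → sumLists-≡0 n k (λ l → f (x ∷ l)) (λ l ∣l∣≡n → f≡0 (x ∷ l) (cong suc ∣l∣≡n))))

sumLists-nonzero : ∀ n k f → sumLists n k f ≢ 0 → ∃ λ l → length l ≡ n × f l ≢ 0
sumLists-nonzero zero    k f ≢0 = [] , refl , (λ f[]≡0 → ≢0 (cong (_+ 0) f[]≡0))
sumLists-nonzero (suc n) k f ≢0 with sumTo-nonzero k _ (≢0 ∘ trans (sumLists-∷ n k f))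
... | x , ≢0ₓ with sumLists-nonzero n k (λ l → f (x ∷ l)) ≢0ₓ
...   | l , ∣l∣≡n , fxl≢0 = x ∷ l , cong suc ∣l∣≡n , fxl≢0

sumLists-widen₁ : ∀ n k f → (∀ l → length l ≡ n → Any (k ≤_) l → f l ≡ 0) →
                  sumLists n k f ≡ sumLists n (suc k) f
sumLists-widen₁ zero    k f f≡0 = refl
sumLists-widen₁ (suc n) k f f≡0 = begin
  sumLists (suc n) k f
    ≡⟨ sumLists-∷ n k f ⟩
  sumTo k (λ x → sumLists n k (λ l → f (x ∷ l)))
    ≡⟨ sumTo-cong k (λ x → sumLists-widen₁ n k (λ l → f (x ∷ l))
                             (λ l ∣l∣≡n big → f≡0 (x ∷ l) (cong suc ∣l∣≡n) (there big))) ⟩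
  sumTo k (λ x → sumLists n (suc k) (λ l → f (x ∷ l)))
    ≡⟨ sym (+-identityʳ _) ⟩
  sumTo k (λ x → sumLists n (suc k) (λ l → f (x ∷ l))) + 0
    ≡⟨ cong (_+_ (sumTo k _)) (sym (sumLists-≡0 n (suc k) (λ l → f (k ∷ l))
                                     (λ l ∣l∣≡n → f≡0 (k ∷ l) (cong suc ∣l∣≡n) (here ≤-refl)))) ⟩
  sumTo (suc k) (λ x → sumLists n (suc k) (λ l → f (x ∷ l)))
    ≡⟨ sym (sumLists-∷ n (suc k) f) ⟩
  sumLists (suc n) (suc k) f ∎
  where open ≡-Reasoning

sumLists-widen : ∀ n k K f → k ≤ K → (∀ l → length l ≡ n → Any (k ≤_) l → f l ≡ 0) →
                 sumLists n k f ≡ sumLists n K f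
sumLists-widen n k K f k≤K f≡0 with m≤n⇒∃[o]m+o≡n k≤K
... | j , refl = trans (widen j) (cong (λ K → sumLists n K f) (+-comm j k))
  where
  widen : ∀ j → sumLists n k f ≡ sumLists n (j + k) f
  widen zero    = refl
  widen (suc j) = trans (widen j) (sumLists-widen₁ n (j + k) f
    (λ l ∣l∣≡n big → f≡0 l ∣l∣≡n (Any.map (≤-trans (m≤n+m k j)) big)))

-- Words read backwards

-- A sequence is handled through its reversal R, so that the last and next-to-last letters, which
-- C and D constrain, are the first two entries of R. isS210ʳ R holds iff reverse R is a 210-avoiding
-- ascent sequence; creates210 l x, like creates210ʳ x (reverse l), says that l ++ x ∷ [] has a 210
-- ending at x.
isS210 : List ℕ → Bool
isS210 x = isAscentSeq x ∧ not (contains210 x)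

creates210 : List ℕ → ℕ → Bool
creates210 []      x = false
creates210 (a ∷ l) x = any (λ b → (b <ᵇ a) ∧ (x <ᵇ b)) l ∨ creates210 l x

ascʳ : List ℕ → ℕ
ascʳ []          = 0
ascʳ (x ∷ [])    = 0
ascʳ (x ∷ y ∷ t) = ascʳ (y ∷ t) + 𝟙 (y <ᵇ x)

headIs : ℕ → List ℕ → Bool
headIs s []      = false
headIs s (x ∷ _) = x ≡ᵇ s

secondIs : ℕ → List ℕ → Bool
secondIs r []          = false
secondIs r (x ∷ [])    = false
secondIs r (x ∷ y ∷ _) = y ≡ᵇ r

creates210ʳ : ℕ → List ℕ → Bool
creates210ʳ x []      = false
creates210ʳ x (b ∷ t) = ((x <ᵇ b) ∧ any (b <ᵇ_) t) ∨ creates210ʳ x t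

isS210ʳ : List ℕ → Bool
isS210ʳ []          = true
isS210ʳ (x ∷ [])    = x ≡ᵇ 0
isS210ʳ (x ∷ y ∷ t) = isS210ʳ (y ∷ t) ∧ ((x ≤ᵇ' suc (ascʳ (y ∷ t))) ∧ not (creates210ʳ x (y ∷ t)))

inCʳ : ℕ → ℕ → ℕ → List ℕ → Bool
inCʳ m r s R = isS210ʳ R ∧ ((ascʳ R ≡ᵇ m) ∧ (maxLetter R ≡ᵇ r) ∧ headIs s R)

inDʳ : ℕ → ℕ → ℕ → List ℕ → Bool
inDʳ m r s R = isS210ʳ R ∧ (((ascʳ R ≡ᵇ m) ∧ (maxLetter R ≡ᵇ r) ∧ headIs s R) ∧ secondIs r R)

asc-∷ʳ : ∀ (u : List ℕ) y x → asc ((u ++ y ∷ []) ++ x ∷ []) ≡ asc (u ++ y ∷ []) + 𝟙 (y <ᵇ x)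
asc-∷ʳ []          y x = +-comm (𝟙 (y <ᵇ x)) 0
asc-∷ʳ (a ∷ [])    y x = trans (cong (_+_ (𝟙 (a <ᵇ y))) (+-identityʳ _))
                               (cong (_+ 𝟙 (y <ᵇ x)) (sym (+-identityʳ _)))
asc-∷ʳ (a ∷ b ∷ u) y x = trans (cong (_+_ (𝟙 (a <ᵇ b))) (asc-∷ʳ (b ∷ u) y x)) (sym (+-assoc (𝟙 (a <ᵇ b)) _ _))

maxLetter-∷ʳ : ∀ (l : List ℕ) x → maxLetter (l ++ x ∷ []) ≡ maxLetter l ⊔ x
maxLetter-∷ʳ []      x = trans (⊔-identityʳ x) (sym (⊔-identityˡ x))
maxLetter-∷ʳ (a ∷ l) x = trans (cong (a ⊔_) (maxLetter-∷ʳ l x)) (sym (⊔-assoc a _ x))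

lastIs-∷ʳ : ∀ s (l : List ℕ) x → lastIs s (l ++ x ∷ []) ≡ (x ≡ᵇ s)
lastIs-∷ʳ s []          x = refl
lastIs-∷ʳ s (a ∷ [])    x = refl
lastIs-∷ʳ s (a ∷ b ∷ l) x = lastIs-∷ʳ s (b ∷ l) x

nextToLastIs-∷ʳ : ∀ r (u : List ℕ) y x → nextToLastIs r ((u ++ y ∷ []) ++ x ∷ []) ≡ (y ≡ᵇ r)
nextToLastIs-∷ʳ r []              y x = refl
nextToLastIs-∷ʳ r (a ∷ [])        y x = refl
nextToLastIs-∷ʳ r (a ∷ b ∷ [])    y x = refl
nextToLastIs-∷ʳ r (a ∷ b ∷ c ∷ u) y x = nextToLastIs-∷ʳ r (b ∷ c ∷ u) y x

ascOK-∷ʳ : ∀ p a (t : List ℕ) x → ascOK p a (t ++ x ∷ []) ≡ ascOK p a t ∧ (x ≤ᵇ' suc (asc (p ∷ t) + a))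
ascOK-∷ʳ p a []      x = ∧-identityʳ _
ascOK-∷ʳ p a (y ∷ t) x = begin
  (y ≤ᵇ' suc a) ∧ ascOK y a' (t ++ x ∷ [])
    ≡⟨ cong ((y ≤ᵇ' suc a) ∧_) (ascOK-∷ʳ y a' t x) ⟩
  (y ≤ᵇ' suc a) ∧ (ascOK y a' t ∧ (x ≤ᵇ' suc (asc (y ∷ t) + a')))
    ≡⟨ sym (∧-assoc (y ≤ᵇ' suc a) _ _) ⟩
  ((y ≤ᵇ' suc a) ∧ ascOK y a' t) ∧ (x ≤ᵇ' suc (asc (y ∷ t) + a'))
    ≡⟨ cong (λ z → ((y ≤ᵇ' suc a) ∧ ascOK y a' t) ∧ (x ≤ᵇ' suc z)) (+-comm-middle (asc (y ∷ t)) (𝟙 (p <ᵇ y)) a) ⟩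
  ((y ≤ᵇ' suc a) ∧ ascOK y a' t) ∧ (x ≤ᵇ' suc ((𝟙 (p <ᵇ y) + asc (y ∷ t)) + a)) ∎
  where
  open ≡-Reasoning
  a' = 𝟙 (p <ᵇ y) + a
  +-comm-middle : ∀ c b a → c + (b + a) ≡ (b + c) + a
  +-comm-middle c b a = trans (sym (+-assoc c b a)) (cong (_+ a) (+-comm c b))

isAscentSeq-∷-∷ʳ : ∀ a w x → isAscentSeq ((a ∷ w) ++ x ∷ []) ≡ isAscentSeq (a ∷ w) ∧ (x ≤ᵇ' suc (asc (a ∷ w)))
isAscentSeq-∷-∷ʳ a w x = begin
  (a ≡ᵇ 0) ∧ ascOK a 0 (w ++ x ∷ [])
    ≡⟨ cong ((a ≡ᵇ 0) ∧_) (ascOK-∷ʳ a 0 w x) ⟩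
  (a ≡ᵇ 0) ∧ (ascOK a 0 w ∧ (x ≤ᵇ' suc (asc (a ∷ w) + 0)))
    ≡⟨ sym (∧-assoc (a ≡ᵇ 0) _ _) ⟩
  isAscentSeq (a ∷ w) ∧ (x ≤ᵇ' suc (asc (a ∷ w) + 0))
    ≡⟨ cong (λ z → isAscentSeq (a ∷ w) ∧ (x ≤ᵇ' suc z)) (+-identityʳ _) ⟩
  isAscentSeq (a ∷ w) ∧ (x ≤ᵇ' suc (asc (a ∷ w))) ∎
  where open ≡-Reasoning

isAscentSeq-∷ʳ : ∀ (u : List ℕ) y x →
                 isAscentSeq ((u ++ y ∷ []) ++ x ∷ []) ≡ isAscentSeq (u ++ y ∷ []) ∧ (x ≤ᵇ' suc (asc (u ++ y ∷ [])))
isAscentSeq-∷ʳ []      y x = isAscentSeq-∷-∷ʳ y [] x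
isAscentSeq-∷ʳ (a ∷ u) y x = isAscentSeq-∷-∷ʳ a (u ++ y ∷ []) x

any-∷ʳ : ∀ (p : ℕ → Bool) (l : List ℕ) x → any p (l ++ x ∷ []) ≡ any p l ∨ p x
any-∷ʳ p []      x = ∨-identityʳ (p x)
any-∷ʳ p (y ∷ l) x = trans (cong (p y ∨_) (any-∷ʳ p l x)) (sym (∨-assoc (p y) _ _))

any-reverse : ∀ (p : ℕ → Bool) (l : List ℕ) → any p (reverse l) ≡ any p l
any-reverse p []      = refl
any-reverse p (y ∷ l) = begin
  any p (reverse (y ∷ l))      ≡⟨ cong (any p) (unfold-reverse y l) ⟩
  any p (reverse l ++ y ∷ [])  ≡⟨ any-∷ʳ p (reverse l) y ⟩
  any p (reverse l) ∨ p y      ≡⟨ cong (_∨ p y) (any-reverse p l) ⟩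
  any p l ∨ p y                ≡⟨ ∨-comm (any p l) (p y) ⟩
  p y ∨ any p l                ∎
  where open ≡-Reasoning

any-filterᵇ : ∀ (p q : ℕ → Bool) (l : List ℕ) → any q (filterᵇ p l) ≡ any (λ z → p z ∧ q z) l
any-filterᵇ p q []      = refl
any-filterᵇ p q (y ∷ l) with p y
... | true  = cong (q y ∨_) (any-filterᵇ p q l)
... | false = any-filterᵇ p q l

filterᵇ-∷ʳ : ∀ (p : ℕ → Bool) (l : List ℕ) x →
             filterᵇ p (l ++ x ∷ []) ≡ filterᵇ p l ++ (if p x then x ∷ [] else [])
filterᵇ-∷ʳ p [] x with p x
... | true  = refl
... | false = refl
filterᵇ-∷ʳ p (y ∷ l) x with p y
... | true  = cong (y ∷_) (filterᵇ-∷ʳ p l x)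
... | false = filterᵇ-∷ʳ p l x

has21-∷ʳ : ∀ (l : List ℕ) x → has21 (l ++ x ∷ []) ≡ has21 l ∨ any (x <ᵇ_) l
has21-∷ʳ []      x = refl
has21-∷ʳ (y ∷ l) x = trans (cong₂ _∨_ (any-∷ʳ (_<ᵇ y) l x) (has21-∷ʳ l x))
                           (∨-interchange (any (_<ᵇ y) l) (x <ᵇ y) (has21 l) (any (x <ᵇ_) l))

creates210-below : ∀ x a (l : List ℕ) → ¬ x < a → any (λ b → (b <ᵇ a) ∧ (x <ᵇ b)) l ≡ false
creates210-below x a []      x≮a = refl
creates210-below x a (b ∷ l) x≮a with (b <ᵇ a) ∧ (x <ᵇ b) in x<b<a
... | false = creates210-below x a l x≮a
... | true  = contradiction (<-trans (<ᵇ⇒< x b x<b) (<ᵇ⇒< b a b<a)) x≮a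
  where
  b<a = proj₁ (T-∧⁻ (subst T (sym x<b<a) tt))
  x<b = proj₂ (T-∧⁻ {b <ᵇ a} (subst T (sym x<b<a) tt))

contains210-∷ʳ : ∀ (l : List ℕ) x → contains210 (l ++ x ∷ []) ≡ contains210 l ∨ creates210 l x
contains210-∷ʳ []      x = refl
contains210-∷ʳ (a ∷ l) x = begin
  has21 (filterᵇ (_<ᵇ a) (l ++ x ∷ [])) ∨ contains210 (l ++ x ∷ [])
    ≡⟨ cong₂ _∨_ (cong has21 (filterᵇ-∷ʳ (_<ᵇ a) l x)) (contains210-∷ʳ l x) ⟩
  has21 (F ++ (if x <ᵇ a then x ∷ [] else [])) ∨ (contains210 l ∨ creates210 l x)
    ≡⟨ cong (_∨ (contains210 l ∨ creates210 l x)) (new21 (x <ᵇ a) refl) ⟩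
  (has21 F ∨ Q) ∨ (contains210 l ∨ creates210 l x)
    ≡⟨ ∨-interchange (has21 F) Q (contains210 l) (creates210 l x) ⟩
  (has21 F ∨ contains210 l) ∨ (Q ∨ creates210 l x) ∎
  where
  open ≡-Reasoning
  F = filterᵇ (_<ᵇ a) l
  Q = any (λ b → (b <ᵇ a) ∧ (x <ᵇ b)) l
  new21 : ∀ c → (x <ᵇ a) ≡ c → has21 (F ++ (if c then x ∷ [] else [])) ≡ has21 F ∨ Q
  new21 true  _ = trans (has21-∷ʳ F x) (cong (has21 F ∨_) (any-filterᵇ (_<ᵇ a) (x <ᵇ_) l))
  new21 false x≮ᵇa = begin
    has21 (F ++ [])  ≡⟨ cong has21 (++-identityʳ F) ⟩
    has21 F          ≡⟨ sym (∨-identityʳ (has21 F)) ⟩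
    has21 F ∨ false  ≡⟨ cong (has21 F ∨_) (sym (creates210-below x a l (λ x<a → subst T x≮ᵇa (<⇒<ᵇ x<a)))) ⟩
    has21 F ∨ Q      ∎

creates210-∷ʳ : ∀ (l : List ℕ) b x → creates210 (l ++ b ∷ []) x ≡ creates210 l x ∨ ((x <ᵇ b) ∧ any (b <ᵇ_) l)
creates210-∷ʳ []      b x = sym (cong (false ∨_) (∧-zeroʳ (x <ᵇ b)))
creates210-∷ʳ (a ∷ l) b x = begin
  any (λ c → (c <ᵇ a) ∧ (x <ᵇ c)) (l ++ b ∷ []) ∨ creates210 (l ++ b ∷ []) x
    ≡⟨ cong₂ _∨_ (any-∷ʳ (λ c → (c <ᵇ a) ∧ (x <ᵇ c)) l b) (creates210-∷ʳ l b x) ⟩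
  (A ∨ ((b <ᵇ a) ∧ (x <ᵇ b))) ∨ (creates210 l x ∨ ((x <ᵇ b) ∧ B))
    ≡⟨ ∨-interchange A _ (creates210 l x) _ ⟩
  (A ∨ creates210 l x) ∨ (((b <ᵇ a) ∧ (x <ᵇ b)) ∨ ((x <ᵇ b) ∧ B))
    ≡⟨ cong (λ z → (A ∨ creates210 l x) ∨ (z ∨ ((x <ᵇ b) ∧ B))) (∧-comm (b <ᵇ a) (x <ᵇ b)) ⟩
  (A ∨ creates210 l x) ∨ (((x <ᵇ b) ∧ (b <ᵇ a)) ∨ ((x <ᵇ b) ∧ B))
    ≡⟨ cong ((A ∨ creates210 l x) ∨_) (sym (∧-distribˡ-∨ (x <ᵇ b) (b <ᵇ a) B)) ⟩
  (A ∨ creates210 l x) ∨ ((x <ᵇ b) ∧ ((b <ᵇ a) ∨ B)) ∎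
  where
  open ≡-Reasoning
  A = any (λ c → (c <ᵇ a) ∧ (x <ᵇ c)) l
  B = any (b <ᵇ_) l

creates210-reverse : ∀ (R : List ℕ) x → creates210 (reverse R) x ≡ creates210ʳ x R
creates210-reverse []      x = refl
creates210-reverse (b ∷ t) x = begin
  creates210 (reverse (b ∷ t)) x
    ≡⟨ cong (λ z → creates210 z x) (unfold-reverse b t) ⟩
  creates210 (reverse t ++ b ∷ []) x
    ≡⟨ creates210-∷ʳ (reverse t) b x ⟩
  creates210 (reverse t) x ∨ ((x <ᵇ b) ∧ any (b <ᵇ_) (reverse t))
    ≡⟨ cong₂ (λ u v → u ∨ ((x <ᵇ b) ∧ v)) (creates210-reverse t x) (any-reverse (b <ᵇ_) t) ⟩
  creates210ʳ x t ∨ ((x <ᵇ b) ∧ any (b <ᵇ_) t)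
    ≡⟨ ∨-comm (creates210ʳ x t) _ ⟩
  creates210ʳ x (b ∷ t) ∎
  where open ≡-Reasoning

reverse-∷-∷ : ∀ (x y : ℕ) t → reverse (x ∷ y ∷ t) ≡ (reverse t ++ y ∷ []) ++ x ∷ []
reverse-∷-∷ x y t = trans (unfold-reverse x (y ∷ t)) (cong (_++ x ∷ []) (unfold-reverse y t))

asc-reverse : ∀ R → asc (reverse R) ≡ ascʳ R
asc-reverse []          = refl
asc-reverse (x ∷ [])    = refl
asc-reverse (x ∷ y ∷ t) = begin
  asc (reverse (x ∷ y ∷ t))                      ≡⟨ cong asc (reverse-∷-∷ x y t) ⟩
  asc ((reverse t ++ y ∷ []) ++ x ∷ [])          ≡⟨ asc-∷ʳ (reverse t) y x ⟩
  asc (reverse t ++ y ∷ []) + 𝟙 (y <ᵇ x)         ≡⟨ cong (λ z → asc z + 𝟙 (y <ᵇ x)) (sym (unfold-reverse y t)) ⟩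
  asc (reverse (y ∷ t)) + 𝟙 (y <ᵇ x)             ≡⟨ cong (_+ 𝟙 (y <ᵇ x)) (asc-reverse (y ∷ t)) ⟩
  ascʳ (x ∷ y ∷ t)                               ∎
  where open ≡-Reasoning

maxLetter-reverse : ∀ R → maxLetter (reverse R) ≡ maxLetter R
maxLetter-reverse []      = refl
maxLetter-reverse (x ∷ R) = begin
  maxLetter (reverse (x ∷ R))       ≡⟨ cong maxLetter (unfold-reverse x R) ⟩
  maxLetter (reverse R ++ x ∷ [])   ≡⟨ maxLetter-∷ʳ (reverse R) x ⟩
  maxLetter (reverse R) ⊔ x         ≡⟨ cong (_⊔ x) (maxLetter-reverse R) ⟩
  maxLetter R ⊔ x                   ≡⟨ ⊔-comm _ x ⟩
  maxLetter (x ∷ R)                 ∎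
  where open ≡-Reasoning

lastIs-reverse : ∀ s R → lastIs s (reverse R) ≡ headIs s R
lastIs-reverse s []      = refl
lastIs-reverse s (x ∷ R) = trans (cong (lastIs s) (unfold-reverse x R)) (lastIs-∷ʳ s (reverse R) x)

nextToLastIs-reverse : ∀ r R → nextToLastIs r (reverse R) ≡ secondIs r R
nextToLastIs-reverse r []          = refl
nextToLastIs-reverse r (x ∷ [])    = refl
nextToLastIs-reverse r (x ∷ y ∷ t) = trans (cong (nextToLastIs r) (reverse-∷-∷ x y t)) (nextToLastIs-∷ʳ r (reverse t) y x)

∧-not-∨-interchange : ∀ a b c d → (a ∧ b) ∧ not (c ∨ d) ≡ (a ∧ not c) ∧ (b ∧ not d)
∧-not-∨-interchange false b     c     d = refl
∧-not-∨-interchange true  false false d = refl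
∧-not-∨-interchange true  false true  d = refl
∧-not-∨-interchange true  true  false d = refl
∧-not-∨-interchange true  true  true  d = refl

isS210-reverse : ∀ R → isS210 (reverse R) ≡ isS210ʳ R
isS210-reverse []          = refl
isS210-reverse (x ∷ [])    = trans (∧-identityʳ _) (∧-identityʳ _)
isS210-reverse (x ∷ y ∷ t) = begin
  isS210 (reverse (x ∷ y ∷ t))
    ≡⟨ cong isS210 (reverse-∷-∷ x y t) ⟩
  isAscentSeq (L ++ x ∷ []) ∧ not (contains210 (L ++ x ∷ []))
    ≡⟨ cong₂ (λ u v → u ∧ not v) (isAscentSeq-∷ʳ (reverse t) y x) (contains210-∷ʳ L x) ⟩
  (isAscentSeq L ∧ (x ≤ᵇ' suc (asc L))) ∧ not (contains210 L ∨ creates210 L x)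
    ≡⟨ ∧-not-∨-interchange (isAscentSeq L) (x ≤ᵇ' suc (asc L)) (contains210 L) (creates210 L x) ⟩
  isS210 L ∧ ((x ≤ᵇ' suc (asc L)) ∧ not (creates210 L x))
    ≡⟨ cong₂ (λ u v → u ∧ ((x ≤ᵇ' suc v) ∧ not (creates210 L x)))
             (trans (cong isS210 L≡) (isS210-reverse (y ∷ t))) (trans (cong asc L≡) (asc-reverse (y ∷ t))) ⟩
  isS210ʳ (y ∷ t) ∧ ((x ≤ᵇ' suc (ascʳ (y ∷ t))) ∧ not (creates210 L x))
    ≡⟨ cong (λ v → isS210ʳ (y ∷ t) ∧ ((x ≤ᵇ' suc (ascʳ (y ∷ t))) ∧ not v))
            (trans (cong (λ z → creates210 z x) L≡) (creates210-reverse (y ∷ t) x)) ⟩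
  isS210ʳ (x ∷ y ∷ t) ∎
  where
  open ≡-Reasoning
  L = reverse t ++ y ∷ []
  L≡ : L ≡ reverse (y ∷ t)
  L≡ = sym (unfold-reverse y t)

inC-reverse : ∀ m r s R → isS210 (reverse R) ∧ inC m r s (reverse R) ≡ inCʳ m r s R
inC-reverse m r s R rewrite isS210-reverse R | asc-reverse R | maxLetter-reverse R | lastIs-reverse s R = refl

inD-reverse : ∀ m r s R → isS210 (reverse R) ∧ (inC m r s (reverse R) ∧ nextToLastIs r (reverse R)) ≡ inDʳ m r s R
inD-reverse m r s R
  rewrite isS210-reverse R | asc-reverse R | maxLetter-reverse R | lastIs-reverse s R | nextToLastIs-reverse r R = refl

sumLists-reverse-𝟙 : ∀ n (p : List ℕ → Bool) (q : List ℕ → Bool) → (∀ R → p (reverse R) ≡ q R) →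
                     sumLists n n (𝟙 ∘ p) ≡ sumLists n n (𝟙 ∘ q)
sumLists-reverse-𝟙 n p q p∘reverse≡q = trans
  (sumLists-cong n n (λ l → cong (𝟙 ∘ p) (sym (reverse-involutive l))))
  (trans (sumLists-cong n n (λ l → cong 𝟙 (p∘reverse≡q (reverse l)))) (sumLists-reverse n n (𝟙 ∘ q)))

c≡sumLists : ∀ n m r s → cℕ n m r s ≡ sumLists n n (𝟙 ∘ inCʳ m r s)
c≡sumLists n m r s = trans (length-filterᵇ-filterᵇ isS210 (inC m r s) (allLists n n))
  (sumLists-reverse-𝟙 n _ (inCʳ m r s) (inC-reverse m r s))

d≡sumLists : ∀ n m r s → dℕ n m r s ≡ sumLists n n (𝟙 ∘ inDʳ m r s)
d≡sumLists n m r s = trans (length-filterᵇ-filterᵇ isS210 (λ x → inC m r s x ∧ nextToLastIs r x) (allLists n n))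
  (sumLists-reverse-𝟙 n _ (inDʳ m r s) (inD-reverse m r s))

≤ᵇ'⇒≤ : ∀ x y → T (x ≤ᵇ' y) → x ≤ y
≤ᵇ'⇒≤ x y x≤y = ≤-pred (<ᵇ⇒< x (suc y) x≤y)

≤⇒≤ᵇ' : ∀ {x y} → x ≤ y → T (x ≤ᵇ' y)
≤⇒≤ᵇ' x≤y = <⇒<ᵇ (s≤s x≤y)

<ᵇ-false : ∀ {x y} → y ≤ x → (x <ᵇ y) ≡ false
<ᵇ-false {x} {y} y≤x with x <ᵇ y in x<ᵇy
... | true  = contradiction y≤x (<⇒≱ (<ᵇ⇒< x y (subst T (sym x<ᵇy) tt)))
... | false = refl

<ᵇ-true : ∀ {x y} → x < y → (x <ᵇ y) ≡ true
<ᵇ-true {x} {y} x<y with x <ᵇ y | <⇒<ᵇ x<y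
... | true | _ = refl

≡ᵇ-refl : ∀ t → T (t ≡ᵇ t)
≡ᵇ-refl t = ≡⇒≡ᵇ t t refl

ascʳ-ascent : ∀ {x y} t → y < x → ascʳ (x ∷ y ∷ t) ≡ suc (ascʳ (y ∷ t))
ascʳ-ascent {x} {y} t y<x = trans (cong (λ b → ascʳ (y ∷ t) + 𝟙 b) (<ᵇ-true y<x)) (+-comm _ 1)

ascʳ-flat : ∀ {x y} t → x ≤ y → ascʳ (x ∷ y ∷ t) ≡ ascʳ (y ∷ t)
ascʳ-flat {x} {y} t x≤y = trans (cong (λ b → ascʳ (y ∷ t) + 𝟙 b) (<ᵇ-false x≤y)) (+-identityʳ _)

ascʳ≤length : ∀ y t → ascʳ (y ∷ t) ≤ length t
ascʳ≤length y []      = z≤n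
ascʳ≤length y (z ∷ t) with z <ᵇ y
... | true  = subst (_≤ suc (length t)) (+-comm 1 (ascʳ (z ∷ t))) (s≤s (ascʳ≤length z t))
... | false = subst (_≤ suc (length t)) (sym (+-identityʳ _)) (m≤n⇒m≤1+n (ascʳ≤length z t))

isS210ʳ-tail : ∀ x y t → T (isS210ʳ (x ∷ y ∷ t)) → T (isS210ʳ (y ∷ t))
isS210ʳ-tail x y t = proj₁ ∘ T-∧⁻

isS210ʳ-bound : ∀ x y t → T (isS210ʳ (x ∷ y ∷ t)) → x ≤ suc (ascʳ (y ∷ t))
isS210ʳ-bound x y t valid = ≤ᵇ'⇒≤ x _ (proj₁ (T-∧⁻ (proj₂ (T-∧⁻ {isS210ʳ (y ∷ t)} valid))))

isS210ʳ-no210 : ∀ x R → T (isS210ʳ (x ∷ R)) → ¬ T (creates210ʳ x R)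
isS210ʳ-no210 x []      valid ()
isS210ʳ-no210 x (y ∷ t) valid = T-not⁻ (proj₂ (T-∧⁻ {x ≤ᵇ' _} (proj₂ (T-∧⁻ {isS210ʳ (y ∷ t)} valid))))

isS210ʳ-∷-∷ : ∀ x y t → T (isS210ʳ (y ∷ t)) → x ≤ suc (ascʳ (y ∷ t)) → ¬ T (creates210ʳ x (y ∷ t)) →
              T (isS210ʳ (x ∷ y ∷ t))
isS210ʳ-∷-∷ x y t valid x≤ no210 = T-∧⁺ valid (T-∧⁺ (≤⇒≤ᵇ' x≤) (T-not⁺ no210))

isS210ʳ-letters : ∀ R k → T (isS210ʳ R) → length R ≤ k → ¬ Any (k ≤_) R
isS210ʳ-letters (x ∷ [])    k valid ∣R∣≤k (here k≤x) with ≡ᵇ⇒≡ x 0 valid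
... | refl = 1+n≰n (≤-trans ∣R∣≤k k≤x)
isS210ʳ-letters (x ∷ y ∷ t) k valid ∣R∣≤k (here k≤x) =
  1+n≰n (≤-trans (≤-trans ∣R∣≤k k≤x) (≤-trans (isS210ʳ-bound x y t valid) (s≤s (ascʳ≤length y t))))
isS210ʳ-letters (x ∷ y ∷ t) k valid ∣R∣≤k (there big) =
  isS210ʳ-letters (y ∷ t) k (isS210ʳ-tail x y t valid) (≤-trans (n≤1+n _) ∣R∣≤k) big

isS210ʳ-max≤asc : ∀ R → T (isS210ʳ R) → maxLetter R ≤ ascʳ R
isS210ʳ-max≤asc []          valid = z≤n
isS210ʳ-max≤asc (x ∷ [])    valid with ≡ᵇ⇒≡ x 0 valid
... | refl = z≤n
isS210ʳ-max≤asc (x ∷ y ∷ t) valid with y <? x | isS210ʳ-max≤asc (y ∷ t) (isS210ʳ-tail x y t valid)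
... | yes y<x | ih = subst (x ⊔ maxLetter (y ∷ t) ≤_) (sym (ascʳ-ascent t y<x))
                           (⊔-lub (isS210ʳ-bound x y t valid) (m≤n⇒m≤1+n ih))
... | no  y≮x | ih = subst (x ⊔ maxLetter (y ∷ t) ≤_) (sym (ascʳ-flat t (≮⇒≥ y≮x)))
                           (⊔-lub (≤-trans (≮⇒≥ y≮x) (≤-trans (m≤m⊔n y (maxLetter t)) ih)) ih)

module _ {m r s : ℕ} where

  inCʳ-valid : ∀ R → T (inCʳ m r s R) → T (isS210ʳ R)
  inCʳ-valid R = proj₁ ∘ T-∧⁻

  inCʳ-asc : ∀ R → T (inCʳ m r s R) → ascʳ R ≡ m
  inCʳ-asc R g = ≡ᵇ⇒≡ _ m (proj₁ (T-∧⁻ (proj₂ (T-∧⁻ {isS210ʳ R} g))))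

  inCʳ-max : ∀ R → T (inCʳ m r s R) → maxLetter R ≡ r
  inCʳ-max R g = ≡ᵇ⇒≡ _ r (proj₁ (T-∧⁻ (proj₂ (T-∧⁻ {ascʳ R ≡ᵇ m} (proj₂ (T-∧⁻ {isS210ʳ R} g))))))

  inCʳ-headIs : ∀ R → T (inCʳ m r s R) → T (headIs s R)
  inCʳ-headIs R g = proj₂ (T-∧⁻ {maxLetter R ≡ᵇ r} (proj₂ (T-∧⁻ {ascʳ R ≡ᵇ m} (proj₂ (T-∧⁻ {isS210ʳ R} g)))))

  inCʳ-head : ∀ x R → T (inCʳ m r s (x ∷ R)) → x ≡ s
  inCʳ-head x R g = ≡ᵇ⇒≡ x s (inCʳ-headIs (x ∷ R) g)

  inDʳ⇒inCʳ : ∀ R → T (inDʳ m r s R) → T (inCʳ m r s R)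
  inDʳ⇒inCʳ R g = T-∧⁺ (proj₁ (T-∧⁻ {isS210ʳ R} g)) (proj₁ (T-∧⁻ (proj₂ (T-∧⁻ {isS210ʳ R} g))))

  inDʳ-secondIs : ∀ R → T (inDʳ m r s R) → T (secondIs r R)
  inDʳ-secondIs R g = proj₂ (T-∧⁻ {(ascʳ R ≡ᵇ m) ∧ (maxLetter R ≡ᵇ r) ∧ headIs s R} (proj₂ (T-∧⁻ {isS210ʳ R} g)))

  inDʳ-second : ∀ x y R → T (inDʳ m r s (x ∷ y ∷ R)) → y ≡ r
  inDʳ-second x y R g = ≡ᵇ⇒≡ y r (inDʳ-secondIs (x ∷ y ∷ R) g)

  inDʳ-head : ∀ x R → T (inDʳ m r s (x ∷ R)) → x ≡ s
  inDʳ-head x R = inCʳ-head x R ∘ inDʳ⇒inCʳ (x ∷ R)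

module _ {m r : ℕ} where

  inCʳ-intro : ∀ x R → T (isS210ʳ (x ∷ R)) → ascʳ (x ∷ R) ≡ m → maxLetter (x ∷ R) ≡ r → T (inCʳ m r x (x ∷ R))
  inCʳ-intro x R valid asc≡ max≡ =
    T-∧⁺ valid (T-∧⁺ (≡⇒≡ᵇ _ m asc≡) (T-∧⁺ (≡⇒≡ᵇ _ r max≡) (≡ᵇ-refl x)))

  inDʳ-intro : ∀ x R → T (inCʳ m r x (x ∷ r ∷ R)) → T (inDʳ m r x (x ∷ r ∷ R))
  inDʳ-intro x R g = T-∧⁺ (proj₁ (T-∧⁻ {isS210ʳ (x ∷ r ∷ R)} g)) (T-∧⁺ (proj₂ (T-∧⁻ {isS210ʳ (x ∷ r ∷ R)} g)) (≡ᵇ-refl r))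

InRange : ℤ → ℤ → ℤ → ℤ → Set
InRange n m r s = (1ℤ ≤ℤ n) × (0ℤ ≤ℤ s) × (s ≤ℤ r) × (r ≤ℤ m) × (m <ℤ n)

inCʳ-inRange : ∀ m r s R → T (inCʳ m r s R) → InRange (+ length R) (+ m) (+ r) (+ s)
inCʳ-inRange m r s []      g = ⊥-elim (inCʳ-headIs {m} {r} {s} [] g)
inCʳ-inRange m r s (x ∷ t) g with inCʳ-asc (x ∷ t) g | inCʳ-max (x ∷ t) g | inCʳ-head x t g
... | refl | refl | refl =
  +≤+ (s≤s z≤n) , +≤+ z≤n , +≤+ (m≤m⊔n x (maxLetter t)) ,
  +≤+ (isS210ʳ-max≤asc (x ∷ t) (inCʳ-valid (x ∷ t) g)) , +<+ (s≤s (ascʳ≤length x t))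

c-support : (n m r s : ℤ) → c n m r s ≢ 0 → InRange n m r s
c-support (+ n) (+ m) (+ r) (+ s) c≢0 with sumLists-nonzero n n _ (c≢0 ∘ trans (c≡sumLists n m r s))
... | R , refl , 𝟙≢0 = inCʳ-inRange m r s R (𝟙≢0⇒T _ 𝟙≢0)
c-support (+ n) (+ m) (+ r) -[1+ s ] c≢0 = ⊥-elim (c≢0 refl)
c-support (+ n) (+ m) -[1+ r ] s     c≢0 = ⊥-elim (c≢0 refl)
c-support (+ n) -[1+ m ] r     s     c≢0 = ⊥-elim (c≢0 refl)
c-support -[1+ n ] m     r     s     c≢0 = ⊥-elim (c≢0 refl)

d-support : (n m r s : ℤ) → d n m r s ≢ 0 → InRange n m r s
d-support (+ n) (+ m) (+ r) (+ s) d≢0 with sumLists-nonzero n n _ (d≢0 ∘ trans (d≡sumLists n m r s))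
... | R , refl , 𝟙≢0 = inCʳ-inRange m r s R (inDʳ⇒inCʳ R (𝟙≢0⇒T _ 𝟙≢0))
d-support (+ n) (+ m) (+ r) -[1+ s ] d≢0 = ⊥-elim (d≢0 refl)
d-support (+ n) (+ m) -[1+ r ] s     d≢0 = ⊥-elim (d≢0 refl)
d-support (+ n) -[1+ m ] r     s     d≢0 = ⊥-elim (d≢0 refl)
d-support -[1+ n ] m     r     s     d≢0 = ⊥-elim (d≢0 refl)

c≡sumLists-wide : ∀ n m r s K → n ≤ K → cℕ n m r s ≡ sumLists n K (𝟙 ∘ inCʳ m r s)
c≡sumLists-wide n m r s K n≤K = trans (c≡sumLists n m r s) (sumLists-widen n n K _ n≤K
  (λ R ∣R∣≡n big → 𝟙-false (λ g → isS210ʳ-letters R n (inCʳ-valid R g) (≤-reflexive ∣R∣≡n) big)))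

d≡sumLists-wide : ∀ n m r s K → n ≤ K → dℕ n m r s ≡ sumLists n K (𝟙 ∘ inDʳ m r s)
d≡sumLists-wide n m r s K n≤K = trans (d≡sumLists n m r s) (sumLists-widen n n K _ n≤K
  (λ R ∣R∣≡n big → 𝟙-false (λ g → isS210ʳ-letters R n (inCʳ-valid R (inDʳ⇒inCʳ R g)) (≤-reflexive ∣R∣≡n) big)))

<⊔⇒⊎ : ∀ {x} a b → x < a ⊔ b → x < a ⊎ x < b
<⊔⇒⊎ a b x<a⊔b with ≤-total a b
... | inj₁ a≤b = inj₂ (subst (_ <_) (m≤n⇒m⊔n≡n a≤b) x<a⊔b)
... | inj₂ b≤a = inj₁ (subst (_ <_) (m≥n⇒m⊔n≡m b≤a) x<a⊔b)

any<ᵇ⇒<maxLetter : ∀ x R → T (any (x <ᵇ_) R) → x < maxLetter R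
any<ᵇ⇒<maxLetter x (b ∷ R) any< with T-∨⁻ any<
... | inj₁ x<b = m<n⇒m<n⊔o (maxLetter R) (<ᵇ⇒< x b x<b)
... | inj₂ any<R = m<n⇒m<o⊔n b (any<ᵇ⇒<maxLetter x R any<R)

<maxLetter⇒any<ᵇ : ∀ x R → x < maxLetter R → T (any (x <ᵇ_) R)
<maxLetter⇒any<ᵇ x (b ∷ R) x<max with <⊔⇒⊎ b (maxLetter R) x<max
... | inj₁ x<b = Equivalence.from T-∨ (inj₁ (<⇒<ᵇ x<b))
... | inj₂ x<R = Equivalence.from T-∨ (inj₂ (<maxLetter⇒any<ᵇ x R x<R))

creates210ʳ⇒<maxLetter : ∀ x R → T (creates210ʳ x R) → x < maxLetter R
creates210ʳ⇒<maxLetter x (b ∷ t) c with T-∨⁻ c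
... | inj₁ x<b<t = m<n⇒m<n⊔o (maxLetter t) (<ᵇ⇒< x b (proj₁ (T-∧⁻ x<b<t)))
... | inj₂ ct    = m<n⇒m<o⊔n b (creates210ʳ⇒<maxLetter x t ct)

creates210ʳ-∷⁻ : ∀ x b t → T (creates210ʳ x (b ∷ t)) → (x < b × b < maxLetter t) ⊎ T (creates210ʳ x t)
creates210ʳ-∷⁻ x b t c with T-∨⁻ c
... | inj₁ x<b<t = inj₁ (<ᵇ⇒< x b (proj₁ (T-∧⁻ x<b<t)) , any<ᵇ⇒<maxLetter b t (proj₂ (T-∧⁻ {x <ᵇ b} x<b<t)))
... | inj₂ ct    = inj₂ ct

creates210ʳ-∷⁺ : ∀ x b t → x < b → b < maxLetter t → T (creates210ʳ x (b ∷ t))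
creates210ʳ-∷⁺ x b t x<b b<max =
  Equivalence.from T-∨ (inj₁ (T-∧⁺ (<⇒<ᵇ x<b) (<maxLetter⇒any<ᵇ b t b<max)))

creates210ʳ-∷-tail : ∀ x b t → T (creates210ʳ x t) → T (creates210ʳ x (b ∷ t))
creates210ʳ-∷-tail x b t c = Equivalence.from (T-∨ {(x <ᵇ b) ∧ any (b <ᵇ_) t}) (inj₂ c)

creates210ʳ-antitone : ∀ {t x} R → t ≤ x → T (creates210ʳ x R) → T (creates210ʳ t R)
creates210ʳ-antitone (b ∷ u) t≤x c with creates210ʳ-∷⁻ _ b u c
... | inj₁ (x<b , b<max) = creates210ʳ-∷⁺ _ b u (≤-<-trans t≤x x<b) b<max
... | inj₂ cu            = creates210ʳ-∷-tail _ b u (creates210ʳ-antitone u t≤x cu)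

creates210ʳ-above-max : ∀ x R → maxLetter R ≤ x → ¬ T (creates210ʳ x R)
creates210ʳ-above-max x R max≤x c = <⇒≱ (creates210ʳ⇒<maxLetter x R c) max≤x

creates210ʳ-weak-ascent : ∀ t x R → t ≤ x → T (isS210ʳ (t ∷ R)) → ¬ T (creates210ʳ x (t ∷ R))
creates210ʳ-weak-ascent t x R t≤x valid c with creates210ʳ-∷⁻ x t R c
... | inj₁ (x<t , _) = <⇒≱ x<t t≤x
... | inj₂ cR        = isS210ʳ-no210 t R valid (creates210ʳ-antitone R t≤x cR)

isS210ʳ-head≤1+asc : ∀ x R → T (isS210ʳ (x ∷ R)) → x ≤ suc (ascʳ (x ∷ R))
isS210ʳ-head≤1+asc x []      valid with ≡ᵇ⇒≡ x 0 valid
... | refl = z≤n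
isS210ʳ-head≤1+asc x (y ∷ u) valid = ≤-trans (isS210ʳ-bound x y u valid) (s≤s (m≤m+n (ascʳ (y ∷ u)) _))

isS210ʳ-repeat : ∀ x R → isS210ʳ (x ∷ x ∷ R) ≡ isS210ʳ (x ∷ R)
isS210ʳ-repeat x R with isS210ʳ (x ∷ R) in valid≡
... | false = refl
... | true  = cong₂ _∧_ (≡-true (≤⇒≤ᵇ' (isS210ʳ-head≤1+asc x R valid)))
                        (≡-true (T-not⁺ (creates210ʳ-weak-ascent x x R ≤-refl valid)))
  where
  valid = subst T (sym valid≡) tt
  ≡-true : ∀ {a} → T a → a ≡ true
  ≡-true {true} _ = refl

ascʳ-repeat : ∀ x R → ascʳ (x ∷ x ∷ R) ≡ ascʳ (x ∷ R)
ascʳ-repeat x R = ascʳ-flat R ≤-refl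

maxLetter-repeat : ∀ x R → maxLetter (x ∷ x ∷ R) ≡ maxLetter (x ∷ R)
maxLetter-repeat x R = trans (sym (⊔-assoc x x _)) (cong (_⊔ maxLetter R) (⊔-idem x))

creates210ʳ-repeat : ∀ y x R → creates210ʳ y (x ∷ x ∷ R) ≡ creates210ʳ y (x ∷ R)
creates210ʳ-repeat y x R = begin
  ((y <ᵇ x) ∧ ((x <ᵇ x) ∨ any (x <ᵇ_) R)) ∨ (A ∨ creates210ʳ y R)
    ≡⟨ cong (λ b → ((y <ᵇ x) ∧ (b ∨ any (x <ᵇ_) R)) ∨ (A ∨ creates210ʳ y R)) (<ᵇ-false {x} ≤-refl) ⟩
  A ∨ (A ∨ creates210ʳ y R)
    ≡⟨ sym (∨-assoc A A _) ⟩
  (A ∨ A) ∨ creates210ʳ y R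
    ≡⟨ cong (_∨ creates210ʳ y R) (∨-idem A) ⟩
  A ∨ creates210ʳ y R ∎
  where
  open ≡-Reasoning
  A = (y <ᵇ x) ∧ any (x <ᵇ_) R

inCʳ-repeat : ∀ m r s x R → inCʳ m r s (x ∷ x ∷ R) ≡ inCʳ m r s (x ∷ R)
inCʳ-repeat m r s x R =
  cong₂ _∧_ (isS210ʳ-repeat x R)
            (cong₂ _∧_ (cong (_≡ᵇ m) (ascʳ-repeat x R)) (cong (λ M → (M ≡ᵇ r) ∧ (x ≡ᵇ s)) (maxLetter-repeat x R)))

inDʳ-repeat₂ : ∀ m r s z x R → inDʳ m r s (z ∷ x ∷ x ∷ R) ≡ inDʳ m r s (z ∷ x ∷ R)
inDʳ-repeat₂ m r s z x R =
  shape-cong (isS210ʳ-repeat x R) (ascʳ-repeat x R) (maxLetter-repeat x R) (creates210ʳ-repeat z x R)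
  where
  shape : Bool → ℕ → ℕ → Bool → Bool
  shape valid a M c = (valid ∧ ((z ≤ᵇ' suc a) ∧ not c))
                    ∧ ((((a + 𝟙 (x <ᵇ z)) ≡ᵇ m) ∧ ((z ⊔ M) ≡ᵇ r) ∧ (z ≡ᵇ s)) ∧ (x ≡ᵇ r))
  shape-cong : ∀ {v v' a a' M M' c c'} → v ≡ v' → a ≡ a' → M ≡ M' → c ≡ c' → shape v a M c ≡ shape v' a' M' c'
  shape-cong refl refl refl refl = refl

-- Deleting the last letters

⊔≡⇒≡ : ∀ {a b r} → a ⊔ b ≡ r → a < r → b ≡ r
⊔≡⇒≡ {a} {b} a⊔b≡r a<r with ≤-total a b
... | inj₁ a≤b = trans (sym (m≤n⇒m⊔n≡n a≤b)) a⊔b≡r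
... | inj₂ b≤a = contradiction (trans (sym (m≥n⇒m⊔n≡m b≤a)) a⊔b≡r) (<⇒≢ a<r)

ascʳ-peak : ∀ {s r t} R → s ≤ r → t < r → ascʳ (s ∷ r ∷ t ∷ R) ≡ suc (ascʳ (t ∷ R))
ascʳ-peak R s≤r t<r = trans (ascʳ-flat (_ ∷ R) s≤r) (ascʳ-ascent R t<r)

creates210ʳ-∷-max⁻ : ∀ s r u → maxLetter u ≤ r → T (creates210ʳ s (r ∷ u)) → T (creates210ʳ s u)
creates210ʳ-∷-max⁻ s r u max≤r c with creates210ʳ-∷⁻ s r u c
... | inj₁ (_ , r<max) = contradiction max≤r (<⇒≱ r<max)
... | inj₂ cu          = cu

isS210ʳ-insert-max : ∀ r t R → T (isS210ʳ (t ∷ R)) → r ≤ suc (ascʳ (t ∷ R)) → maxLetter (t ∷ R) ≤ r →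
                     T (isS210ʳ (r ∷ t ∷ R))
isS210ʳ-insert-max r t R valid r≤ max≤r = isS210ʳ-∷-∷ r t R valid r≤ (creates210ʳ-above-max r (t ∷ R) max≤r)

inDʳ-insert-max : ∀ m r s t R → T (isS210ʳ (t ∷ R)) → ascʳ (t ∷ R) ≡ m → maxLetter (t ∷ R) ≤ r →
                  t < r → s < r → r ≤ suc m → ¬ T (creates210ʳ s (t ∷ R)) →
                  T (inDʳ (suc m) r s (s ∷ r ∷ t ∷ R))
inDʳ-insert-max m r s t R valid asc≡ max≤r t<r s<r r≤ no210 =
  inDʳ-intro s (t ∷ R) (inCʳ-intro s (r ∷ t ∷ R) validₛ ascₛ maxₛ)
  where
  validᵣ = isS210ʳ-insert-max r t R valid (subst (λ a → r ≤ suc a) (sym asc≡) r≤) max≤r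
  ascₛ : ascʳ (s ∷ r ∷ t ∷ R) ≡ suc m
  ascₛ = trans (ascʳ-peak R (<⇒≤ s<r) t<r) (cong suc asc≡)
  validₛ = isS210ʳ-∷-∷ s r (t ∷ R) validᵣ
             (subst (λ a → s ≤ suc a) (sym (trans (ascʳ-ascent R t<r) (cong suc asc≡))) (≤-trans (<⇒≤ s<r) (m≤n⇒m≤1+n r≤)))
             (no210 ∘ creates210ʳ-∷-max⁻ s r (t ∷ R) max≤r)
  maxₛ = trans (cong (s ⊔_) (m≥n⇒m⊔n≡m max≤r)) (m≤n⇒m⊔n≡n (<⇒≤ s<r))

inDʳ-remove-max : ∀ m r s t R → t < r → s < r → T (inDʳ (suc m) r s (s ∷ r ∷ t ∷ R)) →
                  T (isS210ʳ (t ∷ R)) × ascʳ (t ∷ R) ≡ m × ¬ T (creates210ʳ s (t ∷ R))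
inDʳ-remove-max m r s t R t<r s<r g =
  isS210ʳ-tail r t R validᵣ ,
  suc-injective (trans (sym (ascʳ-peak R (<⇒≤ s<r) t<r)) (inCʳ-asc (s ∷ r ∷ t ∷ R) gc)) ,
  isS210ʳ-no210 s (r ∷ t ∷ R) validₛ ∘ creates210ʳ-∷-tail s r (t ∷ R)
  where
  gc = inDʳ⇒inCʳ (s ∷ r ∷ t ∷ R) g
  validₛ = inCʳ-valid (s ∷ r ∷ t ∷ R) gc
  validᵣ = isS210ʳ-tail s r (t ∷ R) validₛ

inCʳ-last-ascent : ∀ m r s t R → t < s → s < r → r ≤ suc m →
                   T (inCʳ (suc m) r s (s ∷ t ∷ R)) ⇔ T (inCʳ m r t (t ∷ R))
inCʳ-last-ascent m r s t R t<s s<r r≤ = mk⇔ to from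
  where
  to : T (inCʳ (suc m) r s (s ∷ t ∷ R)) → T (inCʳ m r t (t ∷ R))
  to g = inCʳ-intro t R (isS210ʳ-tail s t R (inCʳ-valid (s ∷ t ∷ R) g))
           (suc-injective (trans (sym (ascʳ-ascent R t<s)) (inCʳ-asc (s ∷ t ∷ R) g)))
           (⊔≡⇒≡ (inCʳ-max (s ∷ t ∷ R) g) s<r)
  from : T (inCʳ m r t (t ∷ R)) → T (inCʳ (suc m) r s (s ∷ t ∷ R))
  from g = inCʳ-intro s (t ∷ R)
             (isS210ʳ-∷-∷ s t R valid (subst (λ a → s ≤ suc a) (sym asc≡) (≤-trans (<⇒≤ s<r) r≤))
                          (creates210ʳ-weak-ascent t s R (<⇒≤ t<s) valid))
             (trans (ascʳ-ascent R t<s) (cong suc asc≡))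
             (trans (cong (s ⊔_) (inCʳ-max (t ∷ R) g)) (m≤n⇒m⊔n≡n (<⇒≤ s<r)))
    where
    valid = inCʳ-valid (t ∷ R) g
    asc≡  = inCʳ-asc (t ∷ R) g

inCʳ-last-descent : ∀ m r s t R → s < t → s < r →
                    T (inCʳ m r s (s ∷ t ∷ R)) ⇔ T (inDʳ m r s (s ∷ t ∷ R))
inCʳ-last-descent m r s t R s<t s<r = mk⇔ to (inDʳ⇒inCʳ (s ∷ t ∷ R))
  where
  t≡r : T (inCʳ m r s (s ∷ t ∷ R)) → t ≡ r
  t≡r g = ≤-antisym (subst (t ≤_) max≡ (m≤m⊔n t (maxLetter R))) (≮⇒≥ t≮r)
    where
    max≡ = ⊔≡⇒≡ (inCʳ-max (s ∷ t ∷ R) g) s<r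
    t≮r : ¬ t < r
    t≮r t<r with <⊔⇒⊎ t (maxLetter R) (subst (t <_) (sym max≡) t<r)
    ... | inj₁ t<t    = <-irrefl refl t<t
    ... | inj₂ t<maxR = isS210ʳ-no210 s (t ∷ R) (inCʳ-valid (s ∷ t ∷ R) g) (creates210ʳ-∷⁺ s t R s<t t<maxR)
  to : T (inCʳ m r s (s ∷ t ∷ R)) → T (inDʳ m r s (s ∷ t ∷ R))
  to g with t≡r g
  ... | refl = inDʳ-intro s R g

inDʳ-low : ∀ m r s t R → t ≤ s → s < r → r ≤ suc m → maxLetter (t ∷ R) ≤ r →
           T (inDʳ (suc m) r s (s ∷ r ∷ t ∷ R)) ⇔ T (inCʳ m (maxLetter (t ∷ R)) t (t ∷ R))
inDʳ-low m r s t R t≤s s<r r≤ max≤r = mk⇔ to from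
  where
  t<r = ≤-<-trans t≤s s<r
  to : T (inDʳ (suc m) r s (s ∷ r ∷ t ∷ R)) → T (inCʳ m (maxLetter (t ∷ R)) t (t ∷ R))
  to g with inDʳ-remove-max m r s t R t<r s<r g
  ... | valid , asc≡ , _ = inCʳ-intro t R valid asc≡ refl
  from : T (inCʳ m (maxLetter (t ∷ R)) t (t ∷ R)) → T (inDʳ (suc m) r s (s ∷ r ∷ t ∷ R))
  from g = inDʳ-insert-max m r s t R valid (inCʳ-asc (t ∷ R) g) max≤r t<r s<r r≤
             (creates210ʳ-weak-ascent t s R t≤s valid)
    where valid = inCʳ-valid (t ∷ R) g

inDʳ-middle : ∀ m r s t R → s < t → t < r → r ≤ suc m →
              T (inDʳ (suc m) r s (s ∷ r ∷ t ∷ R)) ⇔ T (inDʳ m t s (s ∷ t ∷ R))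
inDʳ-middle m r s t R s<t t<r r≤ = mk⇔ to from
  where
  s<r = <-trans s<t t<r
  to : T (inDʳ (suc m) r s (s ∷ r ∷ t ∷ R)) → T (inDʳ m t s (s ∷ t ∷ R))
  to g with inDʳ-remove-max m r s t R t<r s<r g
  ... | valid , asc≡ , no210 = inDʳ-intro s R (inCʳ-intro s (t ∷ R) validₛ (trans (ascʳ-flat R (<⇒≤ s<t)) asc≡) maxₛ)
    where
    validₛ = isS210ʳ-∷-∷ s t R valid (subst (λ a → s ≤ suc a) (sym asc≡) (m≤n⇒m≤1+n (≤-pred (≤-trans s<r r≤)))) no210
    maxR≤t : maxLetter R ≤ t
    maxR≤t = ≮⇒≥ (λ t<maxR → no210 (creates210ʳ-∷⁺ s t R s<t t<maxR))
    maxₛ = trans (cong (s ⊔_) (m≥n⇒m⊔n≡m maxR≤t)) (m≤n⇒m⊔n≡n (<⇒≤ s<t))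
  from : T (inDʳ m t s (s ∷ t ∷ R)) → T (inDʳ (suc m) r s (s ∷ r ∷ t ∷ R))
  from g = inDʳ-insert-max m r s t R (isS210ʳ-tail s t R validₛ) asc≡ (≤-trans max≤t (<⇒≤ t<r)) t<r s<r r≤
             (isS210ʳ-no210 s (t ∷ R) validₛ)
    where
    gc     = inDʳ⇒inCʳ (s ∷ t ∷ R) g
    validₛ = inCʳ-valid (s ∷ t ∷ R) gc
    asc≡   = trans (sym (ascʳ-flat R (<⇒≤ s<t))) (inCʳ-asc (s ∷ t ∷ R) gc)
    max≤t  = subst (maxLetter (t ∷ R) ≤_) (inCʳ-max (s ∷ t ∷ R) gc) (m≤n⊔m s _)

inCʳ-remove-max : ∀ m r t R → t < r → r ≤ suc m → maxLetter (t ∷ R) ≤ r →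
                  T (inCʳ (suc m) r r (r ∷ t ∷ R)) ⇔ T (inCʳ m (maxLetter (t ∷ R)) t (t ∷ R))
inCʳ-remove-max m r t R t<r r≤ max≤r = mk⇔ to from
  where
  to : T (inCʳ (suc m) r r (r ∷ t ∷ R)) → T (inCʳ m (maxLetter (t ∷ R)) t (t ∷ R))
  to g = inCʳ-intro t R (isS210ʳ-tail r t R (inCʳ-valid (r ∷ t ∷ R) g))
           (suc-injective (trans (sym (ascʳ-ascent R t<r)) (inCʳ-asc (r ∷ t ∷ R) g))) refl
  from : T (inCʳ m (maxLetter (t ∷ R)) t (t ∷ R)) → T (inCʳ (suc m) r r (r ∷ t ∷ R))
  from g = inCʳ-intro r (t ∷ R)
             (isS210ʳ-insert-max r t R (inCʳ-valid (t ∷ R) g) (subst (λ a → r ≤ suc a) (sym asc≡) r≤) max≤r)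
             (trans (ascʳ-ascent R t<r) (cong suc asc≡))
             (m≥n⇒m⊔n≡m max≤r)
    where asc≡ = inCʳ-asc (t ∷ R) g

≡+0+0 : ∀ {a b c d} → a ≡ b → c ≡ 0 → d ≡ 0 → a ≡ b + c + d
≡+0+0 {b = b} refl refl refl = sym (trans (+-identityʳ _) (+-identityʳ b))

≡0++0 : ∀ {a b c d} → a ≡ c → b ≡ 0 → d ≡ 0 → a ≡ b + c + d
≡0++0 {c = c} refl refl refl = sym (+-identityʳ c)

≡0+0+ : ∀ {a b c d} → a ≡ d → b ≡ 0 → c ≡ 0 → a ≡ b + c + d
≡0+0+ refl refl refl = refl

≡+0 : ∀ {a b c} → a ≡ b → c ≡ 0 → a ≡ b + c
≡+0 {b = b} refl refl = sym (+-identityʳ b)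

≡0+ : ∀ {a b c} → a ≡ c → b ≡ 0 → a ≡ b + c
≡0+ refl refl = refl

𝟙-inCʳ-other-head : ∀ m r i t R → i ≢ t → 𝟙 (inCʳ m r i (t ∷ R)) ≡ 0
𝟙-inCʳ-other-head m r i t R i≢t = 𝟙-false (i≢t ∘ sym ∘ inCʳ-head t R)

𝟙-inDʳ-other-second : ∀ m r s x t R → t ≢ r → 𝟙 (inDʳ m r s (x ∷ t ∷ R)) ≡ 0
𝟙-inDʳ-other-second m r s x t R t≢r = 𝟙-false (t≢r ∘ inDʳ-second x t R)

sumFT-inCʳ-max : ∀ m t R b → maxLetter (t ∷ R) ≤ b →
                 sumFT t b (λ j → 𝟙 (inCʳ m j t (t ∷ R))) ≡ 𝟙 (inCʳ m (maxLetter (t ∷ R)) t (t ∷ R))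
sumFT-inCʳ-max m t R b max≤b = sumFT-single t b _ _ (m≤m⊔n t _) max≤b
  (λ j j≢max → 𝟙-false (j≢max ∘ sym ∘ inCʳ-max {m} {j} {t} (t ∷ R)))

sumFT-inCʳ-above : ∀ m t R b → ¬ maxLetter (t ∷ R) ≤ b → sumFT t b (λ j → 𝟙 (inCʳ m j t (t ∷ R))) ≡ 0
sumFT-inCʳ-above m t R b max≰b = sumFT-≡0 t b _
  (λ j _ j≤b → 𝟙-false (λ g → max≰b (subst (_≤ b) (sym (inCʳ-max {m} {j} {t} (t ∷ R) g)) j≤b)))

𝟙-inDʳ-low : ∀ m r s t R → t ≤ s → s < r → r ≤ suc m →
             𝟙 (inDʳ (suc m) r s (s ∷ r ∷ t ∷ R)) ≡ sumFT t r (λ j → 𝟙 (inCʳ m j t (t ∷ R)))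
𝟙-inDʳ-low m r s t R t≤s s<r r≤ with maxLetter (t ∷ R) ≤? r
... | yes max≤r = trans (𝟙-cong (inDʳ-low m r s t R t≤s s<r r≤ max≤r)) (sym (sumFT-inCʳ-max m t R r max≤r))
... | no  max≰r = trans (𝟙-false (λ g → max≰r (subst (maxLetter (t ∷ R) ≤_)
                                     (inCʳ-max (s ∷ r ∷ t ∷ R) (inDʳ⇒inCʳ (s ∷ r ∷ t ∷ R) g))
                                     (≤-trans (m≤n⊔m r _) (m≤n⊔m s _)))))
                        (sym (sumFT-inCʳ-above m t R r max≰r))

𝟙-inCʳ-remove-max : ∀ m r t R → t < r → r ≤ suc m →
                    𝟙 (inCʳ (suc m) r r (r ∷ t ∷ R)) ≡ sumFT t r (λ j → 𝟙 (inCʳ m j t (t ∷ R)))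
𝟙-inCʳ-remove-max m r t R t<r r≤ with maxLetter (t ∷ R) ≤? r
... | yes max≤r = trans (𝟙-cong (inCʳ-remove-max m r t R t<r r≤ max≤r)) (sym (sumFT-inCʳ-max m t R r max≤r))
... | no  max≰r = trans (𝟙-false (λ g → max≰r (subst (maxLetter (t ∷ R) ≤_) (inCʳ-max (r ∷ t ∷ R) g) (m≤n⊔m r _))))
                        (sym (sumFT-inCʳ-above m t R r max≰r))

𝟙-inDʳ-repeat : ∀ m r R → 𝟙 (inDʳ m r r (r ∷ R)) ≡ 𝟙 (inCʳ m r r R)
𝟙-inDʳ-repeat m r [] = trans (𝟙-false (inDʳ-secondIs {m} {r} {r} (r ∷ []))) (sym (𝟙-false (inCʳ-headIs {m} {r} {r} [])))
𝟙-inDʳ-repeat m r (t ∷ R) with t ≟ r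
... | yes refl = 𝟙-cong (mk⇔ (subst T (inCʳ-repeat m t t t R) ∘ inDʳ⇒inCʳ (t ∷ t ∷ R))
                            (inDʳ-intro t R ∘ subst T (sym (inCʳ-repeat m t t t R))))
... | no  t≢r  = trans (𝟙-inDʳ-other-second m r r r t R t≢r) (sym (𝟙-inCʳ-other-head m r r t R (t≢r ∘ sym)))

𝟙-inCʳ-split : ∀ m r s R → s < r → r ≤ suc m →
  𝟙 (inCʳ (suc m) r s (s ∷ R))
    ≡ 𝟙 (inCʳ (suc m) r s R) + 𝟙 (inDʳ (suc m) r s (s ∷ R)) + sumTo s (λ i → 𝟙 (inCʳ m r i R))
𝟙-inCʳ-split m r s [] s<r r≤ =
  ≡+0+0 (trans (𝟙-false (λ g → <⇒≢ s<r (trans (sym (⊔-identityʳ s)) (inCʳ-max {suc m} {r} {s} (s ∷ []) g))))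
               (sym (𝟙-false (inCʳ-headIs {suc m} {r} {s} []))))
        (𝟙-false (inDʳ-secondIs {suc m} {r} {s} (s ∷ [])))
        (sumTo-≡0 s _ (λ i _ → 𝟙-false (inCʳ-headIs {m} {r} {i} [])))
𝟙-inCʳ-split m r s (t ∷ R) s<r r≤ with <-cmp t s
... | tri≈ _ refl _ =
  ≡+0+0 (cong 𝟙 (inCʳ-repeat (suc m) r t t R))
        (𝟙-inDʳ-other-second (suc m) r t t t R (<⇒≢ s<r))
        (sumTo-≡0 t _ (λ i i<t → 𝟙-inCʳ-other-head m r i t R (<⇒≢ i<t)))
... | tri< t<s _ _ =
  ≡0+0+ (trans (𝟙-cong (inCʳ-last-ascent m r s t R t<s s<r r≤))
               (sym (sumTo-single s _ t t<s (λ i i≢t → 𝟙-inCʳ-other-head m r i t R i≢t))))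
        (𝟙-inCʳ-other-head (suc m) r s t R (<⇒≢ t<s ∘ sym))
        (𝟙-inDʳ-other-second (suc m) r s s t R (<⇒≢ (<-trans t<s s<r)))
... | tri> _ _ s<t =
  ≡0++0 (𝟙-cong (inCʳ-last-descent (suc m) r s t R s<t s<r))
        (𝟙-inCʳ-other-head (suc m) r s t R (<⇒≢ s<t))
        (sumTo-≡0 s _ (λ i i<s → 𝟙-inCʳ-other-head m r i t R (<⇒≢ (<-trans i<s s<t))))

𝟙-inCʳ-split-max : ∀ m r t R → r ≤ m →
  𝟙 (inCʳ m r r (r ∷ t ∷ R))
    ≡ 𝟙 (inDʳ m r r (r ∷ t ∷ R)) + sumTo r (λ i → sumFT i r (λ j → 𝟙 (inCʳ (m ∸ 1) j i (t ∷ R))))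
𝟙-inCʳ-split-max m r t R r≤m with <-cmp t r
... | tri≈ _ refl _ =
  ≡+0 (𝟙-cong (mk⇔ (inDʳ-intro t R) (inDʳ⇒inCʳ (t ∷ t ∷ R))))
      (sumTo-≡0 t _ (λ i i<t → sumFT-≡0 i t _ (λ j _ _ → 𝟙-inCʳ-other-head (m ∸ 1) j i t R (<⇒≢ i<t))))
... | tri> _ _ r<t =
  ≡+0 (trans (𝟙-false (λ g → <⇒≱ r<t (subst (t ≤_) (inCʳ-max (r ∷ t ∷ R) g) (≤-trans (m≤m⊔n t _) (m≤n⊔m r _)))))
             (sym (𝟙-inDʳ-other-second m r r r t R (<⇒≢ r<t ∘ sym))))
      (sumTo-≡0 r _ (λ i i<r → sumFT-≡0 i r _ (λ j _ _ → 𝟙-inCʳ-other-head (m ∸ 1) j i t R (<⇒≢ (<-trans i<r r<t)))))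
... | tri< t<r _ _ with m
...   | zero  = contradiction (≤-<-trans z≤n t<r) (≤⇒≯ r≤m)
...   | suc m′ = ≡0+ (trans (𝟙-inCʳ-remove-max m′ r t R t<r r≤m)
                            (sym (sumTo-single r _ t t<r (λ i i≢t → sumFT-≡0 i r _
                                   (λ j _ _ → 𝟙-inCʳ-other-head m′ j i t R i≢t)))))
                     (𝟙-inDʳ-other-second (suc m′) r r r t R (<⇒≢ t<r))

≤pred⇒< : ∀ {i t} → 0 < t → i ≤ t ∸ 1 → i < t
≤pred⇒< {t = suc t} _ i≤t = s≤s i≤t

𝟙-inDʳ-split-above : ∀ m r s t R → s < t → s < r → r ≤ suc m →
  𝟙 (inDʳ (suc m) r s (s ∷ r ∷ t ∷ R))
    ≡ 𝟙 (inDʳ (suc m) r s (s ∷ t ∷ R))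
      + sumFT (s + 1) (r ∸ 1) (λ i → 𝟙 (inDʳ m i s (s ∷ t ∷ R)))
      + sumFT 0 s (λ i → sumFT i r (λ j → 𝟙 (inCʳ m j i (t ∷ R))))
𝟙-inDʳ-split-above m r s t R s<t s<r r≤ with <-cmp t r
... | tri< t<r _ _ =
  ≡0++0 (trans (𝟙-cong (inDʳ-middle m r s t R s<t t<r r≤))
               (sym (sumFT-single (s + 1) (r ∸ 1) _ t (subst (_≤ t) (+-comm 1 s) s<t) (<⇒≤pred t<r)
                      (λ i i≢t → 𝟙-inDʳ-other-second m i s s t R (i≢t ∘ sym)))))
        (𝟙-inDʳ-other-second (suc m) r s s t R (<⇒≢ t<r))
        (sumFT-≡0 0 s _ (λ i _ i≤s → sumFT-≡0 i r _ (λ j _ _ → 𝟙-inCʳ-other-head m j i t R (<⇒≢ (≤-<-trans i≤s s<t)))))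
... | tri≈ _ refl _ =
  ≡+0+0 (cong 𝟙 (inDʳ-repeat₂ (suc m) t s s t R))
        (sumFT-≡0 (s + 1) (t ∸ 1) _ (λ i _ i≤ → 𝟙-inDʳ-other-second m i s s t R
                                      (<⇒≢ (≤pred⇒< (≤-<-trans z≤n s<t) i≤) ∘ sym)))
        (sumFT-≡0 0 s _ (λ i _ i≤s → sumFT-≡0 i t _ (λ j _ _ → 𝟙-inCʳ-other-head m j i t R (<⇒≢ (≤-<-trans i≤s s<t)))))
... | tri> _ _ r<t =
  ≡+0+0 (trans (𝟙-false (λ g → <⇒≱ r<t (subst (t ≤_) (inCʳ-max (s ∷ r ∷ t ∷ R) (inDʳ⇒inCʳ (s ∷ r ∷ t ∷ R) g))
                                          (≤-trans (m≤m⊔n t _) (≤-trans (m≤n⊔m r _) (m≤n⊔m s _))))))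
               (sym (𝟙-inDʳ-other-second (suc m) r s s t R (<⇒≢ r<t ∘ sym))))
        (sumFT-≡0 (s + 1) (r ∸ 1) _ (λ i _ i≤ → 𝟙-inDʳ-other-second m i s s t R
                                      (<⇒≢ (≤-<-trans (≤-trans i≤ (m∸n≤m r 1)) r<t) ∘ sym)))
        (sumFT-≡0 0 s _ (λ i _ i≤s → sumFT-≡0 i r _ (λ j _ _ → 𝟙-inCʳ-other-head m j i t R
                                                              (<⇒≢ (≤-<-trans i≤s (<-trans s<r r<t))))))

𝟙-inDʳ-split : ∀ m r s R → s < r → r ≤ suc m →
  𝟙 (inDʳ (suc m) r s (s ∷ r ∷ R))
    ≡ 𝟙 (inDʳ (suc m) r s (s ∷ R))
      + sumFT (s + 1) (r ∸ 1) (λ i → 𝟙 (inDʳ m i s (s ∷ R)))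
      + sumFT 0 s (λ i → sumFT i r (λ j → 𝟙 (inCʳ m j i R)))
𝟙-inDʳ-split m r s [] s<r r≤ =
  ≡+0+0 (trans (𝟙-false (λ g → <⇒≢ (≤-<-trans z≤n s<r) (sym (≡ᵇ⇒≡ r 0 (isS210ʳ-tail s r []
                                   (inCʳ-valid (s ∷ r ∷ []) (inDʳ⇒inCʳ (s ∷ r ∷ []) g)))))))
               (sym (𝟙-false (inDʳ-secondIs {suc m} {r} {s} (s ∷ [])))))
        (sumFT-≡0 (s + 1) (r ∸ 1) _ (λ i _ _ → 𝟙-false (inDʳ-secondIs {m} {i} {s} (s ∷ []))))
        (sumFT-≡0 0 s _ (λ i _ _ → sumFT-≡0 i r _ (λ j _ _ → 𝟙-false (inCʳ-headIs {m} {j} {i} []))))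
𝟙-inDʳ-split m r s (t ∷ R) s<r r≤ with t ≤? s
... | yes t≤s =
  ≡0+0+ (trans (𝟙-inDʳ-low m r s t R t≤s s<r r≤)
               (sym (sumFT-single 0 s _ t z≤n t≤s (λ i i≢t → sumFT-≡0 i r _
                      (λ j _ _ → 𝟙-inCʳ-other-head m j i t R i≢t)))))
        (𝟙-inDʳ-other-second (suc m) r s s t R (<⇒≢ (≤-<-trans t≤s s<r)))
        (sumFT-≡0 (s + 1) (r ∸ 1) _ (λ i s+1≤i _ → 𝟙-inDʳ-other-second m i s s t R
                                      (<⇒≢ (≤-<-trans t≤s (subst (_≤ i) (+-comm s 1) s+1≤i)))))
... | no t≰s = 𝟙-inDʳ-split-above m r s t R (≰⇒> t≰s) s<r r≤

-- The recurrences

c≡sumLists-last : ∀ n m r s K → suc n ≤ K → s < K → cℕ (suc n) m r s ≡ sumLists n K (λ R → 𝟙 (inCʳ m r s (s ∷ R)))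
c≡sumLists-last n m r s K n<K s<K = trans (c≡sumLists-wide (suc n) m r s K n<K)
  (sumLists-head n K _ s s<K (λ x R x≢s → 𝟙-inCʳ-other-head m r s x R (x≢s ∘ sym)))

d≡sumLists-last : ∀ n m r s K → suc n ≤ K → s < K → dℕ (suc n) m r s ≡ sumLists n K (λ R → 𝟙 (inDʳ m r s (s ∷ R)))
d≡sumLists-last n m r s K n<K s<K = trans (d≡sumLists-wide (suc n) m r s K n<K)
  (sumLists-head n K _ s s<K (λ x R x≢s → 𝟙-false (x≢s ∘ inDʳ-head x R)))

d≡sumLists-last-two : ∀ n m r s K → suc (suc n) ≤ K → s < K → r < K →
                      dℕ (suc (suc n)) m r s ≡ sumLists n K (λ R → 𝟙 (inDʳ m r s (s ∷ r ∷ R)))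
d≡sumLists-last-two n m r s K n<K s<K r<K = trans (d≡sumLists-last (suc n) m r s K n<K s<K)
  (sumLists-head n K _ r r<K (λ x R x≢r → 𝟙-inDʳ-other-second m r s s x R x≢r))

-- cℕ n only enumerates letters below n; counts of different lengths (≤ n + 2, with letters ≤ m + 1)
-- are compared after widening all of them to the alphabet bound K.
module _ (n m : ℕ) where

  private
    K : ℕ
    K = suc (suc n) + suc m

    2+n≤K : suc (suc n) ≤ K
    2+n≤K = m≤m+n (suc (suc n)) (suc m)

    1+n≤K : suc n ≤ K
    1+n≤K = ≤-trans (n≤1+n (suc n)) 2+n≤K

    n≤K : n ≤ K
    n≤K = ≤-trans (n≤1+n n) 1+n≤K

    <K : ∀ {r} → r ≤ suc m → r < K
    <K r≤ = ≤-<-trans r≤ (m<n+m (suc m) {suc (suc n)} z<s)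

  c-recurrence : ∀ r s → s < r → r ≤ suc m →
    cℕ (suc (suc n)) (suc m) r s
      ≡ cℕ (suc n) (suc m) r s + dℕ (suc (suc n)) (suc m) r s + sumTo s (λ i → cℕ (suc n) m r i)
  c-recurrence r s s<r r≤ = begin
    cℕ (suc (suc n)) (suc m) r s
      ≡⟨ c≡sumLists-last (suc n) (suc m) r s K 2+n≤K s<K ⟩
    sumLists (suc n) K (λ R → 𝟙 (inCʳ (suc m) r s (s ∷ R)))
      ≡⟨ sumLists-cong (suc n) K (λ R → 𝟙-inCʳ-split m r s R s<r r≤) ⟩
    sumLists (suc n) K (λ R → 𝟙 (inCʳ (suc m) r s R) + 𝟙 (inDʳ (suc m) r s (s ∷ R)) + sumTo s (λ i → 𝟙 (inCʳ m r i R)))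
      ≡⟨ sumLists-+₃ (suc n) K _ _ _ ⟩
    sumLists (suc n) K (𝟙 ∘ inCʳ (suc m) r s) + sumLists (suc n) K (λ R → 𝟙 (inDʳ (suc m) r s (s ∷ R)))
      + sumLists (suc n) K (λ R → sumTo s (λ i → 𝟙 (inCʳ m r i R)))
      ≡⟨ cong₂ _+_ (cong₂ _+_ (sym (c≡sumLists-wide (suc n) (suc m) r s K 1+n≤K))
                              (sym (d≡sumLists-last (suc n) (suc m) r s K 2+n≤K s<K)))
                   (trans (sumLists-sumTo (suc n) K s (λ i R → 𝟙 (inCʳ m r i R)))
                          (sumTo-cong s (λ i → sym (c≡sumLists-wide (suc n) m r i K 1+n≤K)))) ⟩
    cℕ (suc n) (suc m) r s + dℕ (suc (suc n)) (suc m) r s + sumTo s (λ i → cℕ (suc n) m r i) ∎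
    where
    open ≡-Reasoning
    s<K = <K (≤-trans (<⇒≤ s<r) r≤)

  d-recurrence : ∀ r s → s < r → r ≤ suc m →
    dℕ (suc (suc n)) (suc m) r s
      ≡ dℕ (suc n) (suc m) r s
        + sumFT (s + 1) (r ∸ 1) (λ i → dℕ (suc n) m i s)
        + sumFT 0 s (λ i → sumFT i r (λ j → cℕ n m j i))
  d-recurrence r s s<r r≤ = begin
    dℕ (suc (suc n)) (suc m) r s
      ≡⟨ d≡sumLists-last-two n (suc m) r s K 2+n≤K s<K (<K r≤) ⟩
    sumLists n K (λ R → 𝟙 (inDʳ (suc m) r s (s ∷ r ∷ R)))
      ≡⟨ sumLists-cong n K (λ R → 𝟙-inDʳ-split m r s R s<r r≤) ⟩
    sumLists n K (λ R → 𝟙 (inDʳ (suc m) r s (s ∷ R))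
                        + sumFT (s + 1) (r ∸ 1) (λ i → 𝟙 (inDʳ m i s (s ∷ R)))
                        + sumFT 0 s (λ i → sumFT i r (λ j → 𝟙 (inCʳ m j i R))))
      ≡⟨ sumLists-+₃ n K _ _ _ ⟩
    sumLists n K (λ R → 𝟙 (inDʳ (suc m) r s (s ∷ R)))
      + sumLists n K (λ R → sumFT (s + 1) (r ∸ 1) (λ i → 𝟙 (inDʳ m i s (s ∷ R))))
      + sumLists n K (λ R → sumFT 0 s (λ i → sumFT i r (λ j → 𝟙 (inCʳ m j i R))))
      ≡⟨ cong₂ _+_ (cong₂ _+_ (sym (d≡sumLists-last n (suc m) r s K 1+n≤K s<K))
                              (trans (sumLists-sumFT n K (s + 1) (r ∸ 1) (λ i R → 𝟙 (inDʳ m i s (s ∷ R))))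
                                     (sumFT-cong (s + 1) (r ∸ 1) (λ i → sym (d≡sumLists-last n m i s K 1+n≤K s<K)))))
                   (trans (sumLists-sumFT n K 0 s (λ i R → sumFT i r (λ j → 𝟙 (inCʳ m j i R))))
                          (sumFT-cong 0 s (λ i → trans (sumLists-sumFT n K i r (λ j R → 𝟙 (inCʳ m j i R)))
                                                       (sumFT-cong i r (λ j → sym (c≡sumLists-wide n m j i K n≤K)))))) ⟩
    dℕ (suc n) (suc m) r s
      + sumFT (s + 1) (r ∸ 1) (λ i → dℕ (suc n) m i s)
      + sumFT 0 s (λ i → sumFT i r (λ j → cℕ n m j i)) ∎
    where
    open ≡-Reasoning
    s<K = <K (≤-trans (<⇒≤ s<r) r≤)

  c-recurrence-max : ∀ r → r ≤ m →
    cℕ (suc (suc n)) m r r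
      ≡ dℕ (suc (suc n)) m r r + sumTo r (λ i → sumFT i r (λ j → cℕ (suc n) (m ∸ 1) j i))
  c-recurrence-max r r≤m = begin
    cℕ (suc (suc n)) m r r
      ≡⟨ c≡sumLists-last (suc n) m r r K 2+n≤K r<K ⟩
    sumLists (suc n) K (λ R → 𝟙 (inCʳ m r r (r ∷ R)))
      ≡⟨ sumLists-cong-∷ n K (λ t R → 𝟙-inCʳ-split-max m r t R r≤m) ⟩
    sumLists (suc n) K (λ R → 𝟙 (inDʳ m r r (r ∷ R)) + sumTo r (λ i → sumFT i r (λ j → 𝟙 (inCʳ (m ∸ 1) j i R))))
      ≡⟨ sumLists-+ (suc n) K _ _ ⟩
    sumLists (suc n) K (λ R → 𝟙 (inDʳ m r r (r ∷ R)))
      + sumLists (suc n) K (λ R → sumTo r (λ i → sumFT i r (λ j → 𝟙 (inCʳ (m ∸ 1) j i R))))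
      ≡⟨ cong₂ _+_ (sym (d≡sumLists-last (suc n) m r r K 2+n≤K r<K))
                   (trans (sumLists-sumTo (suc n) K r (λ i R → sumFT i r (λ j → 𝟙 (inCʳ (m ∸ 1) j i R))))
                          (sumTo-cong r (λ i → trans (sumLists-sumFT (suc n) K i r (λ j R → 𝟙 (inCʳ (m ∸ 1) j i R)))
                                                     (sumFT-cong i r (λ j → sym (c≡sumLists-wide (suc n) (m ∸ 1) j i K 1+n≤K)))))) ⟩
    dℕ (suc (suc n)) m r r + sumTo r (λ i → sumFT i r (λ j → cℕ (suc n) (m ∸ 1) j i)) ∎
    where
    open ≡-Reasoning
    r<K = <K (m≤n⇒m≤1+n r≤m)

  d-recurrence-max : ∀ r → r ≤ m → dℕ (suc (suc n)) m r r ≡ cℕ (suc n) m r r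
  d-recurrence-max r r≤m = begin
    dℕ (suc (suc n)) m r r                          ≡⟨ d≡sumLists-last (suc n) m r r K 2+n≤K (<K (m≤n⇒m≤1+n r≤m)) ⟩
    sumLists (suc n) K (λ R → 𝟙 (inDʳ m r r (r ∷ R))) ≡⟨ sumLists-cong (suc n) K (𝟙-inDʳ-repeat m r) ⟩
    sumLists (suc n) K (𝟙 ∘ inCʳ m r r)              ≡⟨ sym (c≡sumLists-wide (suc n) m r r K 1+n≤K) ⟩
    cℕ (suc n) m r r                                 ∎
    where open ≡-Reasoning

proposition2 :
    ((n m r s : ℤ) → c n m r s ≢ 0 →
        (1ℤ ≤ℤ n) × (0ℤ ≤ℤ s) × (s ≤ℤ r) × (r ≤ℤ m) × (m <ℤ n))
    × ((n m r s : ℤ) → d n m r s ≢ 0 →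
        (1ℤ ≤ℤ n) × (0ℤ ≤ℤ s) × (s ≤ℤ r) × (r ≤ℤ m) × (m <ℤ n))
    × (c (+ 1) (+ 0) (+ 0) (+ 0) ≡ 1)
    × (d (+ 1) (+ 0) (+ 0) (+ 0) ≡ 0)
    × ((n m r s : ℕ) → 2 ≤ n → s < r → r ≤ m →
        c (+ n) (+ m) (+ r) (+ s)
          ≡ c (+ n - 1ℤ) (+ m) (+ r) (+ s) + d (+ n) (+ m) (+ r) (+ s)
            + sumTo s (λ i → c (+ n - 1ℤ) (+ m - 1ℤ) (+ r) (+ i)))
    × ((n m r s : ℕ) → 2 ≤ n → s < r → r ≤ m →
        d (+ n) (+ m) (+ r) (+ s)
          ≡ d (+ n - 1ℤ) (+ m) (+ r) (+ s)
            + sumFT (s + 1) (r ∸ 1) (λ i → d (+ n - 1ℤ) (+ m - 1ℤ) (+ i) (+ s))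
            + sumFT 0 s (λ i → sumFT i r (λ j →
                c (+ n - + 2) (+ m - 1ℤ) (+ j) (+ i))))
    × ((n m r : ℕ) → 2 ≤ n → r ≤ m →
        c (+ n) (+ m) (+ r) (+ r)
          ≡ d (+ n) (+ m) (+ r) (+ r)
            + sumTo r (λ i → sumFT i r (λ j →
                c (+ n - 1ℤ) (+ m - 1ℤ) (+ j) (+ i))))
    × ((n m r : ℕ) → 2 ≤ n → r ≤ m →
        d (+ n) (+ m) (+ r) (+ r) ≡ c (+ n - 1ℤ) (+ m) (+ r) (+ r))
proposition2 =
  c-support , d-support , refl , refl ,
  (λ { (suc (suc n)) (suc m) r s _ s<r r≤ → c-recurrence n m r s s<r r≤
     ; (suc (suc n)) zero    r s _ s<r r≤ → contradiction (<-≤-trans s<r r≤) λ ()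
     ; (suc zero) _ _ _ (s≤s ()) _ _ }) ,
  (λ { (suc (suc n)) (suc m) r s _ s<r r≤ → d-recurrence n m r s s<r r≤
     ; (suc (suc n)) zero    r s _ s<r r≤ → contradiction (<-≤-trans s<r r≤) λ ()
     ; (suc zero) _ _ _ (s≤s ()) _ _ }) ,
  (λ { (suc (suc n)) (suc m) r    _ r≤  → c-recurrence-max n (suc m) r r≤
     ; (suc (suc n)) zero    zero _ z≤n → c-recurrence-max n zero zero z≤n
     ; (suc zero) _ _ (s≤s ()) _ }) ,
  (λ { (suc (suc n)) m r _ r≤m → d-recurrence-max n m r r≤m
     ; (suc zero) _ _ (s≤s ()) _ })
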